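{- Let $p$ be an odd prime, $q$ a power of $p$, $n\ge 1$, and $V=\{y\in\mathbb{F}_{q^2}: y^q=1-y\}$. Let $S=(\mathbb{F}_q\cup V)\setminus\{\frac12\}$ and $g:S\to\mathbb{F}_{q^2}$, $g(y)=\dfrac{y^n-(1-y)^n}{2y-1}$. Then $F_n(1,x)$ is a permutation polynomial of $\mathbb{F}_q$ if and only if $g$ is a 2-to-1 mapping on $S$ and $g(y)\neq \dfrac{n}{2^{n-1}}$ for every $y\in S$.
   Context: For an integer $n\ge 1$, the $n$-th reversed Dickson polynomial of the third kind is $F_n(a,x)=\sum_{i=0}^{\lfloor n/2\rfloor}\frac{n-2i}{n-i}\binom{n-i}{i}(-x)^i a^{n-2i}$, where the coefficients $\frac{n-2i}{n-i}\binom{n-i}{i}=\binom{n-i}{i}-\binom{n-i-1}{i-1}$ (with $\binom{m}{ -1}=0$) are integers, read in $\mathbb{F}_q$. A polynomial $f\in\mathbb{F}_q[x]$ is a permutation polynomial of $\mathbb{F}_q$ if $c\mapsto f(c)$ is a bijection of $\mathbb{F}_q$. Note $S$ is stable under $y\mapsto 1-y$ and $y\neq 1-y$ on $S$; "$g$ is 2-to-1 on $S$" means that for $y_1,y_2\in S$, $g(y_1)=g(y_2)$ holds if and only if $y_1=y_2$ or $y_1=1-y_2$. Here $\frac12$ and $\frac{n}{2^{n-1}}$ are computed in $\mathbb{F}_p$. -}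

module Defs where

open import Level using (Level; _⊔_)
open import Algebra.Bundles using (CommutativeRing)
open import Data.Nat.Base as ℕ using (ℕ; zero; suc; ⌊_/2⌋; _∸_)
open import Data.Nat.Combinatorics using (_C_)
open import Data.List.Base using (List; foldr; map; upTo)
open import Data.Product.Base using (_×_)
open import Data.Sum.Base using (_⊎_)
open import Relation.Nullary using (¬_)
open import Data.Product.Base using (∃-syntax)

record IsField {c ℓ : Level} (R : CommutativeRing c ℓ) : Set (c ⊔ ℓ) where
  open CommutativeRing R
  field
    _⁻¹      : Carrier → Carrier
    ⁻¹-inv   : ∀ x → ¬ (x ≈ 0#) → (x * (x ⁻¹)) ≈ 1#
    0≉1      : ¬ (0# ≈ 1#)

module FieldDefs {c ℓ : Level} (R : CommutativeRing c ℓ) (isF : IsField R) where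
  open CommutativeRing R
  open IsField isF

  pow : Carrier → ℕ → Carrier
  pow x zero    = 1#
  pow x (suc m) = x * pow x m

  natCast : ℕ → Carrier
  natCast zero    = 0#
  natCast (suc m) = 1# + natCast m

  sumR : List Carrier → Carrier
  sumR = foldr _+_ 0#

  -- coefficient (n-2i)/(n-i) * binom(n-i,i) = binom(n-i,i) - binom(n-i-1,i-1),
  -- with binom(m,-1) = 0
  coeff : ℕ → ℕ → Carrier
  coeff n zero    = natCast ((n ∸ 0) C 0)
  coeff n (suc j) = natCast ((n ∸ suc j) C suc j) - natCast ((n ∸ suc j ∸ 1) C j)

  Dickson3 : ℕ → Carrier → Carrier → Carrier
  Dickson3 n a x =
    sumR (map (λ i → coeff n i * (pow (- x) i * pow a (n ∸ 2 ℕ.* i))) (upTo (suc ⌊ n /2⌋)))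

  InFq : ℕ → Carrier → Set ℓ
  InFq q y = pow y q ≈ y

  InV : ℕ → Carrier → Set ℓ
  InV q y = pow y q ≈ (1# - y)

  two : Carrier
  two = 1# + 1#

  half : Carrier
  half = two ⁻¹

  InS : ℕ → Carrier → Set ℓ
  InS q y = (InFq q y ⊎ InV q y) × ¬ (y ≈ half)

  g : ℕ → Carrier → Carrier
  g n y = (pow y n - pow (1# - y) n) * (((two * y) - 1#) ⁻¹)

  IsPermOfFq : ℕ → (Carrier → Carrier) → Set (c ⊔ ℓ)
  IsPermOfFq q f =
    (∀ x → InFq q x → InFq q (f x)) ×
    (∀ x y → InFq q x → InFq q y → f x ≈ f y → x ≈ y) ×
    (∀ z → InFq q z → ∃[ x ] (InFq q x × f x ≈ z))

  TwoToOneOnS : ℕ → (Carrier → Carrier) → Set (c ⊔ ℓ)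
  TwoToOneOnS q h =
    ∀ y₁ y₂ → InS q y₁ → InS q y₂ →
      (h y₁ ≈ h y₂ → (y₁ ≈ y₂ ⊎ y₁ ≈ (1# - y₂))) ×
      ((y₁ ≈ y₂ ⊎ y₁ ≈ (1# - y₂)) → h y₁ ≈ h y₂)

  nOver2pow : ℕ → Carrier
  nOver2pow n = natCast n * (pow two (n ∸ 1) ⁻¹)

-- Expressing F_n(1, x) through the Fibonacci polynomials U_n(t) = Σ C(n - i, i) t^i gives
-- (2y - 1) F_n(1, y(1 - y)) = y^n - (1 - y)^n, so g(y) = F_n(1, y(1 - y)) for y ≠ 1/2, and 2^n U_n(-1/4) = n + 1
-- gives F_n(1, 1/4) = n / 2^(n-1). The map y ↦ y(1 - y) sends F_q ∪ V onto F_q, identifies exactly y with 1 - y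
-- and sends only 1/2 to 1/4: a preimage of x is (1 + s)/2 with s² = 1 - 4x, where s exists in F_{q²} because
-- every element of F_q is a norm a^(q+1) (a counting argument resting on a^(q²) = a), and the conjugate y^q is
-- again a root, hence y or 1 - y. So F_n(1, ·), which maps F_q to itself by additivity of the Frobenius, is
-- injective on F_q exactly when g is 2-to-1 on S and never takes the value F_n(1, 1/4); on the finite set F_q
-- injectivity is bijectivity.
module Submission where

open import Defs
open import Level using (Level; _⊔_)
open import Algebra.Bundles using (CommutativeRing)
open import Data.Nat.Base as ℕ using (ℕ; zero; suc; _≤_; _<_; z≤n; s≤s; _∸_; ⌊_/2⌋)
import Data.Nat.Properties as ℕ
open import Data.Nat.Primality using (Prime; prime⇒irreducible; prime⇒nonTrivial; prime⇒nonZero; euclidsLemma)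
open import Data.Nat.Divisibility using (_∣_; divides; ∣⇒≤; m∣m*n)
open import Data.Nat.DivMod using (m/n*n≡m)
open import Data.Integer.Base as ℤ using (ℤ; +_; -[1+_])
import Data.Integer.Properties as ℤ
open import Data.Sign.Base as Sign using (Sign)
open import Data.Fin.Base using (Fin)
open import Data.Product.Base using (∃-syntax; _×_; _,_; proj₁; proj₂)
open import Data.Sum.Base as Sum using (_⊎_; inj₁; inj₂; [_,_]′)
open import Data.Empty using (⊥-elim)
open import Data.Maybe.Base using (Maybe; just; nothing)
open import Function.Base using (_∘_)
open import Data.Nat.Combinatorics using (_C_; k>n⇒nCk≡0; nCk+nC[k+1]≡[n+1]C[k+1]; nCk≡n!/k![n-k]!; k![n∸k]!∣n!; nCn≡1)
open import Data.List.Base using (List; []; _∷_; _++_; length; map; filter; foldr; tabulate; applyUpTo)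
open import Data.List.Relation.Unary.All as All using (All; []; _∷_)
import Data.List.Relation.Unary.All.Properties as All
open import Data.List.Relation.Unary.AllPairs using ([]; _∷_)
open import Data.List.Relation.Unary.Any as Any using (here; there; any?)
import Data.List.Properties as List
open import Relation.Binary.Bundles using (DecSetoid)
open import Relation.Unary using (Pred; Decidable)
open import Relation.Unary.Properties using (∁?)
open import Function.Bundles using (Bijection; Inverse)
open import Function.Properties.Bijection using (Bijection⇒Inverse)
import Data.Fin.Properties as Fin
open import Relation.Nullary using (¬_; yes; no; Dec; ¬?; map′; _×-dec_)
open import Relation.Binary.PropositionalEquality as ≡ using (_≡_; _≢_)
open import Algebra.Solver.Ring.AlmostCommutativeRing
  using (_-Raw-AlmostCommutative⟶_) renaming (fromCommutativeRing to almostCommutativeRing)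
import Algebra.Solver.Ring as Solver

module _ where
  open import Data.Nat.Base
  open import Data.Nat.Tactic.RingSolver using (solve-∀)

  even⊎odd : ∀ n → ∃[ m ] (n ≡ m + m ⊎ n ≡ suc (m + m))
  even⊎odd zero = 0 , inj₁ ≡.refl
  even⊎odd (suc n) with even⊎odd n
  ... | m , inj₁ e = m , inj₂ (≡.cong suc e)
  ... | m , inj₂ e = suc m , inj₁ (≡.cong suc (≡.trans e (≡.sym (ℕ.+-suc m m))))

  prime≢2⇒odd : ∀ {p} → Prime p → p ≢ 2 → ∃[ m ] p ≡ suc (m + m)
  prime≢2⇒odd {p} p-prime p≢2 with even⊎odd p
  ... | m , inj₂ p≡1+m+m = m , p≡1+m+m
  ... | m , inj₁ p≡m+m = ⊥-elim ([ (λ ()) , (λ 2≡p → p≢2 (≡.sym 2≡p)) ]′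
    (prime⇒irreducible p-prime (divides m (≡.trans p≡m+m (m+m≡m*2 m)))))
    where
    m+m≡m*2 : ∀ m → m + m ≡ m * 2
    m+m≡m*2 = solve-∀

  odd^ : ∀ {a} k → ∃[ m ] a ≡ suc (m + m) → ∃[ m ] a ^ k ≡ suc (m + m)
  odd^ zero _ = 0 , ≡.refl
  odd^ (suc k) (m , ≡.refl) with odd^ k (m , ≡.refl)
  ... | m′ , e = m + m′ + 2 * m * m′ , ≡.trans (≡.cong (suc (m + m) *_) e) (odd*odd m m′)
    where
    odd*odd : ∀ a b → suc (a + a) * suc (b + b) ≡ suc ((a + b + 2 * a * b) + (a + b + 2 * a * b))
    odd*odd = solve-∀

  oddPrimePower≡3+2c : ∀ {p k} → Prime p → p ≢ 2 → 1 ≤ k → ∃[ c ] p ^ k ≡ suc (suc c + suc c)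
  oddPrimePower≡3+2c {p} {k} p-prime p≢2 1≤k with odd^ k (prime≢2⇒odd p-prime p≢2)
  ... | suc c , e = c , e
  ... | zero , e = ⊥-elim (ℕ.<-irrefl (≡.sym e) (ℕ.<-≤-trans 1<p (^-increasing 1≤k)))
    where
    1<p : 1 < p
    1<p = nonTrivial⇒n>1 p {{prime⇒nonTrivial p-prime}}
    ^-increasing : ∀ {k} → 1 ≤ k → p ≤ p ^ k
    ^-increasing {suc k} _ = ℕ.m≤m*n p (p ^ k) {{ℕ.m^n≢0 p k {{prime⇒nonZero p-prime}}}}

  [3+r]*r<[2+r]²-1 : ∀ r L → (2 + r) * (2 + r) ≡ suc L → (3 + r) * r < L
  [3+r]*r<[2+r]²-1 r L [2+r]²≡1+L = ≡.subst ((3 + r) * r <_) L≡ (ℕ.m<m+n ((3 + r) * r) (s≤s z≤n))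
    where
    expand : ∀ r → (2 + r) * (2 + r) ≡ suc ((3 + r) * r + (3 + r))
    expand = solve-∀
    L≡ : (3 + r) * r + (3 + r) ≡ L
    L≡ = ℕ.suc-injective (≡.trans (≡.sym (expand r)) [2+r]²≡1+L)

  suc-m∸j∸1 : ∀ m j → suc m ∸ j ∸ 1 ≡ m ∸ j
  suc-m∸j∸1 m zero = ≡.refl
  suc-m∸j∸1 zero (suc j) = ≡.cong (_∸ 1) (ℕ.0∸n≡0 j)
  suc-m∸j∸1 (suc m) (suc j) = suc-m∸j∸1 m j

  n≤1+⌊n/2⌋*2 : ∀ n → n ≤ suc (⌊ n /2⌋ + ⌊ n /2⌋)
  n≤1+⌊n/2⌋*2 zero = z≤n
  n≤1+⌊n/2⌋*2 (suc zero) = s≤s z≤n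
  n≤1+⌊n/2⌋*2 (suc (suc n)) = s≤s (s≤s (ℕ.≤-trans (n≤1+⌊n/2⌋*2 n) (ℕ.≤-reflexive (≡.sym (ℕ.+-suc ⌊ n /2⌋ ⌊ n /2⌋)))))

  prime∤m! : ∀ {p} → Prime p → ∀ m → m < p → ¬ (p ∣ m !)
  prime∤m! {p} p-prime zero _ p∣1 = ℕ.<⇒≱ (nonTrivial⇒n>1 p {{prime⇒nonTrivial p-prime}}) (∣⇒≤ p∣1)
  prime∤m! p-prime (suc m) m<p p∣m! with euclidsLemma (suc m) (m !) p-prime p∣m!
  ... | inj₁ p∣1+m = ℕ.<⇒≱ m<p (∣⇒≤ p∣1+m)
  ... | inj₂ p∣m! = prime∤m! p-prime m (ℕ.<-trans (ℕ.n<1+n m) m<p) p∣m!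

  prime∣binomial : ∀ {p k} → Prime p → 0 < k → k < p → p ∣ p C k
  prime∣binomial {p@(suc p′)} {k} p-prime 0<k k<p = [ (λ p∣pCk → p∣pCk) , (⊥-elim ∘ p∤k![p-k]!) ]′
    (euclidsLemma (p C k) (k ! * (p ∸ k) !) p-prime p∣pCk*k![p-k]!)
    where
    instance
      k![p-k]!≢0 : NonZero (k ! * (p ∸ k) !)
      k![p-k]!≢0 = ℕ._!*_!≢0 k (p ∸ k)
    p∣pCk*k![p-k]! : p ∣ (p C k) * (k ! * (p ∸ k) !)
    p∣pCk*k![p-k]! = ≡.subst (p ∣_)
      (≡.sym (≡.trans (≡.cong (_* (k ! * (p ∸ k) !)) (nCk≡n!/k![n-k]! (ℕ.<⇒≤ k<p))) (m/n*n≡m (k![n∸k]!∣n! (ℕ.<⇒≤ k<p)))))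
      (m∣m*n (p′ !))
    p∤k![p-k]! : ¬ (p ∣ k ! * (p ∸ k) !)
    p∤k![p-k]! p∣ = [ prime∤m! p-prime k k<p , prime∤m! p-prime (p ∸ k) (ℕ.∸-monoʳ-< {p} {k} {0} 0<k (ℕ.<⇒≤ k<p)) ]′
      (euclidsLemma (k !) ((p ∸ k) !) p-prime p∣)

-- Algebra.Solver.Ring with integer coefficients needs the canonical map ℤ → R as a homomorphism, which the
-- standard library does not provide for an arbitrary commutative ring.
module IntegerRingSolver {c ℓ} (R : CommutativeRing c ℓ) where
  open CommutativeRing R
  open import Relation.Binary.Reasoning.Setoid setoid
  open import Algebra.Properties.Ring ring using (-‿involutive; -0#≈0#; -1*x≈-x)
  open import Algebra.Properties.AbelianGroup +-abelianGroup using (⁻¹-∙-comm)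
  open import Algebra.Properties.CommutativeSemigroup *-commutativeSemigroup using (interchange)

  -- 1 is sent to 1# itself, so that the solver constants con (+ 1) and con (+ 2) are 1# and 1# + 1# on the nose.
  ⟦_⟧ℕ : ℕ → Carrier
  ⟦ zero ⟧ℕ = 0#
  ⟦ suc zero ⟧ℕ = 1#
  ⟦ suc (suc n) ⟧ℕ = 1# + ⟦ suc n ⟧ℕ

  ⟦suc⟧ℕ : ∀ n → ⟦ suc n ⟧ℕ ≈ 1# + ⟦ n ⟧ℕ
  ⟦suc⟧ℕ zero = sym (+-identityʳ 1#)
  ⟦suc⟧ℕ (suc n) = refl

  ⟦+⟧ℕ : ∀ m n → ⟦ m ℕ.+ n ⟧ℕ ≈ ⟦ m ⟧ℕ + ⟦ n ⟧ℕ
  ⟦+⟧ℕ zero n = sym (+-identityˡ _)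
  ⟦+⟧ℕ (suc m) n = begin
    ⟦ suc (m ℕ.+ n) ⟧ℕ      ≈⟨ ⟦suc⟧ℕ (m ℕ.+ n) ⟩
    1# + ⟦ m ℕ.+ n ⟧ℕ       ≈⟨ +-congˡ (⟦+⟧ℕ m n) ⟩
    1# + (⟦ m ⟧ℕ + ⟦ n ⟧ℕ)  ≈⟨ sym (+-assoc _ _ _) ⟩
    (1# + ⟦ m ⟧ℕ) + ⟦ n ⟧ℕ  ≈⟨ +-congʳ (sym (⟦suc⟧ℕ m)) ⟩
    ⟦ suc m ⟧ℕ + ⟦ n ⟧ℕ     ∎

  ⟦*⟧ℕ : ∀ m n → ⟦ m ℕ.* n ⟧ℕ ≈ ⟦ m ⟧ℕ * ⟦ n ⟧ℕ
  ⟦*⟧ℕ zero n = sym (zeroˡ _)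
  ⟦*⟧ℕ (suc m) n = begin
    ⟦ n ℕ.+ m ℕ.* n ⟧ℕ            ≈⟨ ⟦+⟧ℕ n (m ℕ.* n) ⟩
    ⟦ n ⟧ℕ + ⟦ m ℕ.* n ⟧ℕ         ≈⟨ +-cong (sym (*-identityˡ _)) (⟦*⟧ℕ m n) ⟩
    1# * ⟦ n ⟧ℕ + ⟦ m ⟧ℕ * ⟦ n ⟧ℕ ≈⟨ sym (distribʳ _ _ _) ⟩
    (1# + ⟦ m ⟧ℕ) * ⟦ n ⟧ℕ        ≈⟨ *-congʳ (sym (⟦suc⟧ℕ m)) ⟩
    ⟦ suc m ⟧ℕ * ⟦ n ⟧ℕ           ∎

  ⟦_⟧ℤ : ℤ → Carrier
  ⟦ + n ⟧ℤ = ⟦ n ⟧ℕ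
  ⟦ -[1+ n ] ⟧ℤ = - ⟦ suc n ⟧ℕ

  ⟦_⟧± : Sign → Carrier
  ⟦ Sign.+ ⟧± = 1#
  ⟦ Sign.- ⟧± = - 1#

  ⟦◃⟧ : ∀ s n → ⟦ s ℤ.◃ n ⟧ℤ ≈ ⟦ s ⟧± * ⟦ n ⟧ℕ
  ⟦◃⟧ _ zero = sym (zeroʳ _)
  ⟦◃⟧ Sign.- (suc n) = sym (-1*x≈-x _)
  ⟦◃⟧ Sign.+ (suc n) = sym (*-identityˡ _)

  ⟦sign◃∣∣⟧ : ∀ i → ⟦ i ⟧ℤ ≈ ⟦ ℤ.sign i ⟧± * ⟦ ℤ.∣ i ∣ ⟧ℕ
  ⟦sign◃∣∣⟧ (+ n) = sym (*-identityˡ _)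
  ⟦sign◃∣∣⟧ -[1+ n ] = sym (-1*x≈-x _)

  ⟦*⟧± : ∀ s t → ⟦ s Sign.* t ⟧± ≈ ⟦ s ⟧± * ⟦ t ⟧±
  ⟦*⟧± Sign.- Sign.- = sym (trans (-1*x≈-x (- 1#)) (-‿involutive 1#))
  ⟦*⟧± Sign.- Sign.+ = sym (*-identityʳ _)
  ⟦*⟧± Sign.+ t = sym (*-identityˡ _)

  ⟦*⟧ℤ : ∀ i j → ⟦ i ℤ.* j ⟧ℤ ≈ ⟦ i ⟧ℤ * ⟦ j ⟧ℤ
  ⟦*⟧ℤ i j = begin
    ⟦ (s Sign.* t) ℤ.◃ (m ℕ.* n) ⟧ℤ     ≈⟨ ⟦◃⟧ (s Sign.* t) (m ℕ.* n) ⟩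
    ⟦ s Sign.* t ⟧± * ⟦ m ℕ.* n ⟧ℕ      ≈⟨ *-cong (⟦*⟧± s t) (⟦*⟧ℕ m n) ⟩
    (⟦ s ⟧± * ⟦ t ⟧±) * (⟦ m ⟧ℕ * ⟦ n ⟧ℕ) ≈⟨ interchange _ _ _ _ ⟩
    (⟦ s ⟧± * ⟦ m ⟧ℕ) * (⟦ t ⟧± * ⟦ n ⟧ℕ) ≈⟨ sym (*-cong (⟦sign◃∣∣⟧ i) (⟦sign◃∣∣⟧ j)) ⟩
    ⟦ i ⟧ℤ * ⟦ j ⟧ℤ                      ∎
    where
    s t : Sign
    s = ℤ.sign i
    t = ℤ.sign j
    m n : ℕ
    m = ℤ.∣ i ∣
    n = ℤ.∣ j ∣

  ⟦-⟧ℤ : ∀ i → ⟦ ℤ.- i ⟧ℤ ≈ - ⟦ i ⟧ℤ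
  ⟦-⟧ℤ (+ zero) = sym -0#≈0#
  ⟦-⟧ℤ (+ suc n) = refl
  ⟦-⟧ℤ -[1+ n ] = sym (-‿involutive _)

  ⟦⊖⟧ : ∀ m n → ⟦ m ℤ.⊖ n ⟧ℤ ≈ ⟦ m ⟧ℕ - ⟦ n ⟧ℕ
  ⟦⊖⟧ zero zero = sym (-‿inverseʳ 0#)
  ⟦⊖⟧ zero (suc n) = sym (+-identityˡ _)
  ⟦⊖⟧ (suc m) zero = sym (trans (+-congˡ -0#≈0#) (+-identityʳ _))
  ⟦⊖⟧ (suc m) (suc n) = begin
    ⟦ suc m ℤ.⊖ suc n ⟧ℤ                 ≡⟨ ≡.cong ⟦_⟧ℤ (ℤ.[1+m]⊖[1+n]≡m⊖n m n) ⟩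
    ⟦ m ℤ.⊖ n ⟧ℤ                         ≈⟨ ⟦⊖⟧ m n ⟩
    ⟦ m ⟧ℕ - ⟦ n ⟧ℕ                      ≈⟨ sym (cancel 1# _ _) ⟩
    (1# + ⟦ m ⟧ℕ) - (1# + ⟦ n ⟧ℕ)        ≈⟨ sym (+-cong (⟦suc⟧ℕ m) (-‿cong (⟦suc⟧ℕ n))) ⟩
    ⟦ suc m ⟧ℕ - ⟦ suc n ⟧ℕ              ∎
    where
    cancel : ∀ a x y → (a + x) - (a + y) ≈ x - y
    cancel a x y = begin
      (a + x) + - (a + y)   ≈⟨ +-congˡ (sym (⁻¹-∙-comm a y)) ⟩
      (a + x) + (- a + - y) ≈⟨ +-assoc _ _ _ ⟩
      a + (x + (- a + - y)) ≈⟨ +-congˡ (trans (sym (+-assoc _ _ _)) (trans (+-congʳ (+-comm _ _)) (+-assoc _ _ _))) ⟩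
      a + (- a + (x + - y)) ≈⟨ sym (+-assoc _ _ _) ⟩
      (a + - a) + (x + - y) ≈⟨ trans (+-congʳ (-‿inverseʳ a)) (+-identityˡ _) ⟩
      x - y                 ∎

  ⟦+⟧ℤ : ∀ i j → ⟦ i ℤ.+ j ⟧ℤ ≈ ⟦ i ⟧ℤ + ⟦ j ⟧ℤ
  ⟦+⟧ℤ -[1+ m ] -[1+ n ] = begin
    - ⟦ suc (suc (m ℕ.+ n)) ⟧ℕ      ≡⟨ ≡.cong (λ k → - ⟦ suc k ⟧ℕ) (≡.sym (ℕ.+-suc m n)) ⟩
    - ⟦ suc m ℕ.+ suc n ⟧ℕ          ≈⟨ -‿cong (⟦+⟧ℕ (suc m) (suc n)) ⟩
    - (⟦ suc m ⟧ℕ + ⟦ suc n ⟧ℕ)     ≈⟨ sym (⁻¹-∙-comm _ _) ⟩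
    - ⟦ suc m ⟧ℕ + - ⟦ suc n ⟧ℕ     ∎
  ⟦+⟧ℤ -[1+ m ] (+ n) = trans (⟦⊖⟧ n (suc m)) (+-comm _ _)
  ⟦+⟧ℤ (+ m) -[1+ n ] = ⟦⊖⟧ m (suc n)
  ⟦+⟧ℤ (+ m) (+ n) = ⟦+⟧ℕ m n

  ℤ⟶R : ℤ.+-*-rawRing -Raw-AlmostCommutative⟶ almostCommutativeRing R
  ℤ⟶R = record
    { ⟦_⟧ = ⟦_⟧ℤ ; +-homo = ⟦+⟧ℤ ; *-homo = ⟦*⟧ℤ ; -‿homo = ⟦-⟧ℤ ; 0-homo = refl ; 1-homo = refl }

  _≟ℤ_ : ∀ i j → Maybe (⟦ i ⟧ℤ ≈ ⟦ j ⟧ℤ)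
  i ≟ℤ j with i ℤ.≟ j
  ... | yes ≡.refl = just refl
  ... | no _ = nothing

  open Solver ℤ.+-*-rawRing (almostCommutativeRing R) ℤ⟶R _≟ℤ_ public
    using (solve; _:=_; _:+_; _:*_; :-_; _:-_; con; Polynomial)

  :1 :2 : ∀ {n} → Polynomial n
  :1 = con (+ 1)
  :2 = con (+ 2)

module FieldLemmas {c ℓ} (R : CommutativeRing c ℓ) (isF : IsField R) where
  open CommutativeRing R public hiding (zero)
  open IsField isF public
  open FieldDefs R isF public
  open IntegerRingSolver R public using (solve; _:=_; _:+_; _:*_; :-_; _:-_; :1; :2)
  open import Relation.Binary.Reasoning.Setoid setoid public
  open import Data.List.Relation.Unary.Unique.Setoid setoid using (Unique)

  natCast-+ : ∀ m n → natCast (m ℕ.+ n) ≈ natCast m + natCast n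
  natCast-+ zero n = sym (+-identityˡ _)
  natCast-+ (suc m) n = trans (+-congˡ (natCast-+ m n)) (sym (+-assoc _ _ _))

  natCast-* : ∀ m n → natCast (m ℕ.* n) ≈ natCast m * natCast n
  natCast-* zero n = sym (zeroˡ _)
  natCast-* (suc m) n = begin
    natCast (n ℕ.+ m ℕ.* n)               ≈⟨ natCast-+ n (m ℕ.* n) ⟩
    natCast n + natCast (m ℕ.* n)         ≈⟨ +-cong (sym (*-identityˡ _)) (natCast-* m n) ⟩
    1# * natCast n + natCast m * natCast n ≈⟨ sym (distribʳ _ _ _) ⟩
    (1# + natCast m) * natCast n          ∎

  pow-cong : ∀ {x y} n → x ≈ y → pow x n ≈ pow y n
  pow-cong zero _ = refl
  pow-cong (suc n) x≈y = *-cong x≈y (pow-cong n x≈y)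

  pow-+ : ∀ x m n → pow x (m ℕ.+ n) ≈ pow x m * pow x n
  pow-+ x zero n = sym (*-identityˡ _)
  pow-+ x (suc m) n = trans (*-congˡ (pow-+ x m n)) (sym (*-assoc _ _ _))

  pow-distrib-* : ∀ x y n → pow (x * y) n ≈ pow x n * pow y n
  pow-distrib-* x y zero = sym (*-identityˡ _)
  pow-distrib-* x y (suc n) = trans (*-congˡ (pow-distrib-* x y n))
    (solve 4 (λ a b c d → (a :* b) :* (c :* d) := (a :* c) :* (b :* d)) refl x y (pow x n) (pow y n))

  pow-* : ∀ x m n → pow x (m ℕ.* n) ≈ pow (pow x m) n
  pow-* x m zero = reflexive (≡.cong (pow x) (ℕ.*-zeroʳ m))
  pow-* x m (suc n) = begin
    pow x (m ℕ.* suc n)        ≡⟨ ≡.cong (pow x) (ℕ.*-suc m n) ⟩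
    pow x (m ℕ.+ m ℕ.* n)      ≈⟨ pow-+ x m (m ℕ.* n) ⟩
    pow x m * pow x (m ℕ.* n)  ≈⟨ *-congˡ (pow-* x m n) ⟩
    pow x m * pow (pow x m) n  ∎

  pow-1# : ∀ n → pow 1# n ≈ 1#
  pow-1# zero = refl
  pow-1# (suc n) = trans (*-identityˡ _) (pow-1# n)

  x-y≈0⇒x≈y : ∀ {x y} → x - y ≈ 0# → x ≈ y
  x-y≈0⇒x≈y {x} {y} x-y≈0 = begin
    x            ≈⟨ solve 2 (λ x y → x := (x :- y) :+ y) refl x y ⟩
    (x - y) + y  ≈⟨ +-congʳ x-y≈0 ⟩
    0# + y       ≈⟨ +-identityˡ _ ⟩
    y            ∎

  x≈y⇒x-y≈0 : ∀ {x y} → x ≈ y → x - y ≈ 0#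
  x≈y⇒x-y≈0 {y = y} x≈y = trans (+-congʳ x≈y) (-‿inverseʳ y)

  1≉0 : ¬ (1# ≈ 0#)
  1≉0 1≈0 = 0≉1 (sym 1≈0)

  ⁻¹-inverseˡ : ∀ {x} → ¬ (x ≈ 0#) → (x ⁻¹) * x ≈ 1#
  ⁻¹-inverseˡ {x} x≉0 = trans (*-comm _ _) (⁻¹-inv x x≉0)

  *-cancelˡ : ∀ {a x y} → ¬ (a ≈ 0#) → a * x ≈ a * y → x ≈ y
  *-cancelˡ {a} {x} {y} a≉0 ax≈ay = begin
    x                ≈⟨ sym (*-identityˡ _) ⟩
    1# * x           ≈⟨ *-congʳ (sym (⁻¹-inverseˡ a≉0)) ⟩
    (a ⁻¹ * a) * x   ≈⟨ *-assoc _ _ _ ⟩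
    a ⁻¹ * (a * x)   ≈⟨ *-congˡ ax≈ay ⟩
    a ⁻¹ * (a * y)   ≈⟨ sym (*-assoc _ _ _) ⟩
    (a ⁻¹ * a) * y   ≈⟨ *-congʳ (⁻¹-inverseˡ a≉0) ⟩
    1# * y           ≈⟨ *-identityˡ _ ⟩
    y                ∎

  *-≉0 : ∀ {x y} → ¬ (x ≈ 0#) → ¬ (y ≈ 0#) → ¬ (x * y ≈ 0#)
  *-≉0 {x} x≉0 y≉0 xy≈0 = y≉0 (*-cancelˡ x≉0 (trans xy≈0 (sym (zeroʳ x))))

  pow-≉0 : ∀ {x} n → ¬ (x ≈ 0#) → ¬ (pow x n ≈ 0#)
  pow-≉0 zero _ = 1≉0
  pow-≉0 (suc n) x≉0 = *-≉0 x≉0 (pow-≉0 n x≉0)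

  ⁻¹-unique : ∀ {x y} → x * y ≈ 1# → y ≈ x ⁻¹
  ⁻¹-unique {x} {y} xy≈1 = *-cancelˡ x≉0 (trans xy≈1 (sym (⁻¹-inv x x≉0)))
    where
    x≉0 : ¬ (x ≈ 0#)
    x≉0 x≈0 = 0≉1 (trans (sym (zeroˡ y)) (trans (*-congʳ (sym x≈0)) xy≈1))

  ⁻¹-≉0 : ∀ {x} → ¬ (x ≈ 0#) → ¬ (x ⁻¹ ≈ 0#)
  ⁻¹-≉0 {x} x≉0 x⁻¹≈0 = 0≉1 (trans (sym (zeroʳ x)) (trans (*-congˡ (sym x⁻¹≈0)) (⁻¹-inv x x≉0)))

  x≈z*y⇒x*y⁻¹≈z : ∀ {x y z} → ¬ (y ≈ 0#) → x ≈ z * y → x * y ⁻¹ ≈ z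
  x≈z*y⇒x*y⁻¹≈z {x} {y} {z} y≉0 x≈zy = begin
    x * y ⁻¹        ≈⟨ *-congʳ x≈zy ⟩
    (z * y) * y ⁻¹  ≈⟨ *-assoc _ _ _ ⟩
    z * (y * y ⁻¹)  ≈⟨ *-congˡ (⁻¹-inv y y≉0) ⟩
    z * 1#          ≈⟨ *-identityʳ _ ⟩
    z               ∎

  sumTo : (ℕ → Carrier) → ℕ → Carrier
  sumTo f zero = 0#
  sumTo f (suc m) = f 0 + sumTo (f ∘ suc) m

  sumR-applyUpTo : ∀ (f : ℕ → Carrier) (g : ℕ → ℕ) m → sumR (map f (applyUpTo g m)) ≡ sumTo (f ∘ g) m
  sumR-applyUpTo f g zero = ≡.refl
  sumR-applyUpTo f g (suc m) = ≡.cong (_+_ (f (g 0))) (sumR-applyUpTo f (g ∘ suc) m)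

  sumTo-cong : ∀ {f g : ℕ → Carrier} m → (∀ i → i < m → f i ≈ g i) → sumTo f m ≈ sumTo g m
  sumTo-cong zero _ = refl
  sumTo-cong (suc m) f≈g = +-cong (f≈g 0 (s≤s z≤n)) (sumTo-cong m (λ i i<m → f≈g (suc i) (s≤s i<m)))

  sumTo-+ : ∀ (f g : ℕ → Carrier) m → sumTo (λ i → f i + g i) m ≈ sumTo f m + sumTo g m
  sumTo-+ f g zero = sym (+-identityˡ _)
  sumTo-+ f g (suc m) = trans (+-congˡ (sumTo-+ (f ∘ suc) (g ∘ suc) m))
    (solve 4 (λ a b c d → (a :+ b) :+ (c :+ d) := (a :+ c) :+ (b :+ d)) refl _ _ _ _)

  sumTo-*ˡ : ∀ a (f : ℕ → Carrier) m → sumTo (λ i → a * f i) m ≈ a * sumTo f m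
  sumTo-*ˡ a f zero = sym (zeroʳ _)
  sumTo-*ˡ a f (suc m) = trans (+-congˡ (sumTo-*ˡ a (f ∘ suc) m)) (sym (distribˡ _ _ _))

  sumTo-suc : ∀ (f : ℕ → Carrier) m → sumTo f (suc m) ≈ sumTo f m + f m
  sumTo-suc f zero = +-comm _ _
  sumTo-suc f (suc m) = trans (+-congˡ (sumTo-suc (f ∘ suc) m)) (sym (+-assoc _ _ _))

  sumTo-vanishing : ∀ (f : ℕ → Carrier) m k → (∀ i → m ≤ i → f i ≈ 0#) → sumTo f (k ℕ.+ m) ≈ sumTo f m
  sumTo-vanishing f m zero _ = refl
  sumTo-vanishing f m (suc k) f≈0 = begin
    sumTo f (suc (k ℕ.+ m))           ≈⟨ sumTo-suc f (k ℕ.+ m) ⟩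
    sumTo f (k ℕ.+ m) + f (k ℕ.+ m)   ≈⟨ +-cong (sumTo-vanishing f m k f≈0) (f≈0 (k ℕ.+ m) (ℕ.m≤n+m m k)) ⟩
    sumTo f m + 0#                    ≈⟨ +-identityʳ _ ⟩
    sumTo f m                         ∎

  natCast-C-vanishing : ∀ {a b} → a < b → natCast (a C b) ≈ 0#
  natCast-C-vanishing a<b = reflexive (≡.cong natCast (k>n⇒nCk≡0 a<b))

  fibonacciTerm : ℕ → Carrier → ℕ → Carrier
  fibonacciTerm n t i = natCast ((n ∸ i) C i) * pow t i

  fibonacci : ℕ → Carrier → Carrier
  fibonacci n t = sumTo (fibonacciTerm n t) (suc n)

  fibonacci-0 : ∀ t → fibonacci 0 t ≈ 1#
  fibonacci-0 t = trans (+-identityʳ _) (trans (*-identityʳ _) (+-identityʳ _))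

  fibonacci-1 : ∀ t → fibonacci 1 t ≈ 1#
  fibonacci-1 t = begin
    fibonacciTerm 1 t 0 + (fibonacciTerm 1 t 1 + 0#)  ≈⟨ +-cong (trans (*-identityʳ _) (+-identityʳ _)) (trans (+-identityʳ _) (zeroˡ _)) ⟩
    1# + 0#                                           ≈⟨ +-identityʳ _ ⟩
    1#                                                ∎

  fibonacci-rec : ∀ n t → fibonacci (suc (suc n)) t ≈ fibonacci (suc n) t + t * fibonacci n t
  fibonacci-rec n t = begin
    u₂ 0 + sumTo (u₂ ∘ suc) (suc (suc n))                  ≈⟨ +-congˡ (sumTo-suc (u₂ ∘ suc) (suc n)) ⟩
    u₂ 0 + (sumTo (u₂ ∘ suc) (suc n) + u₂ (suc (suc n)))   ≈⟨ +-congˡ (trans (+-congˡ last≈0) (+-identityʳ _)) ⟩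
    u₂ 0 + sumTo (u₂ ∘ suc) (suc n)                        ≈⟨ +-cong (trans (*-identityʳ _) (sym (*-identityʳ _))) (sumTo-cong (suc n) pascal) ⟩
    u₁ 0 + sumTo (λ j → u₁ (suc j) + t * u₀ j) (suc n)     ≈⟨ +-congˡ (sumTo-+ (u₁ ∘ suc) (λ j → t * u₀ j) (suc n)) ⟩
    u₁ 0 + (sumTo (u₁ ∘ suc) (suc n) + sumTo (λ j → t * u₀ j) (suc n)) ≈⟨ +-congˡ (+-congˡ (sumTo-*ˡ t u₀ (suc n))) ⟩
    u₁ 0 + (sumTo (u₁ ∘ suc) (suc n) + t * fibonacci n t)  ≈⟨ sym (+-assoc _ _ _) ⟩
    fibonacci (suc n) t + t * fibonacci n t                ∎
    where
    u₂ u₁ u₀ : ℕ → Carrier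
    u₂ = fibonacciTerm (suc (suc n)) t
    u₁ = fibonacciTerm (suc n) t
    u₀ = fibonacciTerm n t
    last≈0 : u₂ (suc (suc n)) ≈ 0#
    last≈0 = trans (*-congʳ (natCast-C-vanishing (s≤s (ℕ.≤-trans (ℕ.≤-reflexive (ℕ.n∸n≡0 n)) z≤n)))) (zeroˡ _)
    pascal : ∀ j → j < suc n → u₂ (suc j) ≈ u₁ (suc j) + t * u₀ j
    pascal j (s≤s j≤n) = begin
      natCast ((suc n ∸ j) C suc j) * pow t (suc j)
        ≡⟨ ≡.cong (λ k → natCast (k C suc j) * pow t (suc j)) (ℕ.+-∸-assoc 1 j≤n) ⟩
      natCast (suc (n ∸ j) C suc j) * pow t (suc j)
        ≡⟨ ≡.cong (λ k → natCast k * pow t (suc j)) (≡.sym (nCk+nC[k+1]≡[n+1]C[k+1] (n ∸ j) j)) ⟩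
      natCast ((n ∸ j) C j ℕ.+ (n ∸ j) C suc j) * pow t (suc j)
        ≈⟨ *-congʳ (natCast-+ ((n ∸ j) C j) ((n ∸ j) C suc j)) ⟩
      (natCast ((n ∸ j) C j) + natCast ((n ∸ j) C suc j)) * (t * pow t j)
        ≈⟨ solve 4 (λ a b t p → (a :+ b) :* (t :* p) := b :* (t :* p) :+ t :* (a :* p)) refl _ _ t (pow t j) ⟩
      u₁ (suc j) + t * u₀ j ∎

  dickson3-cong : ∀ n {x x′} → x ≈ x′ → Dickson3 n 1# x ≈ Dickson3 n 1# x′
  dickson3-cong n {x} {x′} x≈x′ = begin
    Dickson3 n 1# x                 ≡⟨ sumR-applyUpTo (term x) (λ i → i) (suc ⌊ n /2⌋) ⟩
    sumTo (term x) (suc ⌊ n /2⌋)   ≈⟨ sumTo-cong (suc ⌊ n /2⌋) (λ i _ → *-congˡ {coeff n i} (*-congʳ {pow 1# (n ∸ 2 ℕ.* i)} (pow-cong i (-‿cong x≈x′)))) ⟩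
    sumTo (term x′) (suc ⌊ n /2⌋)  ≡⟨ ≡.sym (sumR-applyUpTo (term x′) (λ i → i) (suc ⌊ n /2⌋)) ⟩
    Dickson3 n 1# x′                ∎
    where
    term : Carrier → ℕ → Carrier
    term x i = coeff n i * (pow (- x) i * pow 1# (n ∸ 2 ℕ.* i))

  dickson3-1 : ∀ x → Dickson3 1 1# x ≈ 1#
  dickson3-1 x = trans (+-identityʳ _) (trans (*-cong (+-identityʳ 1#) (trans (*-identityˡ _) (*-identityˡ _))) (*-identityˡ _))

  coeff-vanishing : ∀ m j → ⌊ suc (suc m) /2⌋ ≤ j → coeff (suc (suc m)) (suc j) ≈ 0#
  coeff-vanishing m j ⌊n/2⌋≤j = begin
    natCast ((suc m ∸ j) C suc j) - natCast ((suc m ∸ j ∸ 1) C j)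
      ≈⟨ +-cong (natCast-C-vanishing (s≤s a≤j)) (-‿cong (natCast-C-vanishing (pred-< a≤j))) ⟩
    0# - 0#  ≈⟨ -‿inverseʳ 0# ⟩
    0#       ∎
    where
    1+m≤j+j : suc m ≤ j ℕ.+ j
    1+m≤j+j = ℕ.≤-pred (ℕ.≤-trans (n≤1+⌊n/2⌋*2 (suc (suc m))) (s≤s (ℕ.+-mono-≤ ⌊n/2⌋≤j ⌊n/2⌋≤j)))
    a≤j : suc m ∸ j ≤ j
    a≤j = ℕ.m≤n+o⇒m∸n≤o (suc m) j 1+m≤j+j
    pred-< : ∀ {a} → a ≤ j → a ∸ 1 < j
    pred-< {zero} _ = positive 1+m≤j+j
      where
      positive : ∀ {k} → suc m ≤ k ℕ.+ k → 0 < k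
      positive {suc k} _ = s≤s z≤n
    pred-< {suc a} a<j = a<j

  dickson3-fibonacci : ∀ m x → Dickson3 (suc (suc m)) 1# x ≈ fibonacci (suc (suc m)) (- x) + x * fibonacci m (- x)
  dickson3-fibonacci m x = begin
    Dickson3 n 1# x                          ≡⟨ sumR-applyUpTo F (λ i → i) (suc h) ⟩
    sumTo F (suc h)                          ≈⟨ sumTo-cong (suc h) (λ i _ → *-congˡ {coeff n i} (trans (*-congˡ (pow-1# (n ∸ 2 ℕ.* i))) (*-identityʳ (pow t i)))) ⟩
    sumTo G (suc h)                          ≈⟨ sym (sumTo-vanishing G (suc h) (n ∸ h) G-vanishing) ⟩
    sumTo G ((n ∸ h) ℕ.+ suc h)              ≡⟨ ≡.cong (sumTo G) length≡ ⟩
    G 0 + sumTo (G ∘ suc) (suc (suc m))      ≈⟨ +-congˡ (sumTo-cong (suc (suc m)) (λ j _ → G-suc j)) ⟩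
    G 0 + sumTo (λ j → u (suc j) + x * u′ j) (suc (suc m))        ≈⟨ +-congˡ (sumTo-+ (u ∘ suc) (λ j → x * u′ j) (suc (suc m))) ⟩
    G 0 + (sumTo (u ∘ suc) (suc (suc m)) + sumTo (λ j → x * u′ j) (suc (suc m))) ≈⟨ +-congˡ (+-congˡ (sumTo-*ˡ x u′ (suc (suc m)))) ⟩
    G 0 + (sumTo (u ∘ suc) (suc (suc m)) + x * sumTo u′ (suc (suc m)))          ≈⟨ +-congˡ (+-congˡ (*-congˡ u′-last)) ⟩
    G 0 + (sumTo (u ∘ suc) (suc (suc m)) + x * fibonacci m (- x))               ≈⟨ sym (+-assoc _ _ _) ⟩
    fibonacci n (- x) + x * fibonacci m (- x) ∎
    where
    n h : ℕ
    n = suc (suc m)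
    h = ⌊ n /2⌋
    t : Carrier
    t = - x
    u u′ : ℕ → Carrier
    u = fibonacciTerm n t
    u′ = fibonacciTerm m t
    F G : ℕ → Carrier
    F i = coeff n i * (pow t i * pow 1# (n ∸ 2 ℕ.* i))
    G i = coeff n i * pow t i
    G-vanishing : ∀ i → suc h ≤ i → G i ≈ 0#
    G-vanishing (suc j) (s≤s h≤j) = trans (*-congʳ (coeff-vanishing m j h≤j)) (zeroˡ _)
    length≡ : (n ∸ h) ℕ.+ suc h ≡ suc n
    length≡ = ≡.trans (ℕ.+-suc (n ∸ h) h) (≡.cong suc (ℕ.m∸n+n≡m (ℕ.⌊n/2⌋≤n n)))
    G-suc : ∀ j → G (suc j) ≈ u (suc j) + x * u′ j
    G-suc j = begin
      (natCast ((suc m ∸ j) C suc j) - natCast ((suc m ∸ j ∸ 1) C j)) * pow t (suc j)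
        ≡⟨ ≡.cong (λ k → (natCast ((suc m ∸ j) C suc j) - natCast (k C j)) * pow t (suc j)) (suc-m∸j∸1 m j) ⟩
      (natCast ((suc m ∸ j) C suc j) - natCast ((m ∸ j) C j)) * (- x * pow t j)
        ≈⟨ solve 4 (λ a b x p → (a :- b) :* (:- x :* p) := a :* (:- x :* p) :+ x :* (b :* p)) refl _ _ x (pow t j) ⟩
      u (suc j) + x * u′ j ∎
    u′-last : sumTo u′ (suc (suc m)) ≈ fibonacci m t
    u′-last = trans (sumTo-suc u′ (suc m))
      (trans (+-congˡ (trans (*-congʳ (natCast-C-vanishing (s≤s (ℕ.m∸n≤m m (suc m))))) (zeroˡ _))) (+-identityʳ _))

  fibonacci-quadratic : ∀ n y → (two * y - 1#) * fibonacci n (- (y * (1# - y))) ≈ pow y (suc n) - pow (1# - y) (suc n)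
  fibonacci-quadratic zero y = trans (*-congˡ (fibonacci-0 (- (y * (1# - y)))))
    (solve 1 (λ y → (:2 :* y :- :1) :* :1 := y :* :1 :- (:1 :- y) :* :1) refl y)
  fibonacci-quadratic (suc zero) y = trans (*-congˡ (fibonacci-1 (- (y * (1# - y)))))
    (solve 1 (λ y → (:2 :* y :- :1) :* :1 := y :* (y :* :1) :- (:1 :- y) :* ((:1 :- y) :* :1)) refl y)
  fibonacci-quadratic (suc (suc n)) y = begin
    L * fibonacci (suc (suc n)) t                  ≈⟨ *-congˡ (fibonacci-rec n t) ⟩
    L * (fibonacci (suc n) t + t * fibonacci n t)  ≈⟨ solve 4 (λ l a t b → l :* (a :+ t :* b) := l :* a :+ t :* (l :* b)) refl L _ t _ ⟩
    L * fibonacci (suc n) t + t * (L * fibonacci n t) ≈⟨ +-cong (fibonacci-quadratic (suc n) y) (*-congˡ (fibonacci-quadratic n y)) ⟩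
    (pow y (suc (suc n)) - pow (1# - y) (suc (suc n))) + t * (pow y (suc n) - pow (1# - y) (suc n))
      ≈⟨ solve 3 (λ y a b → (y :* a :- (:1 :- y) :* b) :+ (:- (y :* (:1 :- y))) :* (a :- b)
                           := y :* (y :* a) :- (:1 :- y) :* ((:1 :- y) :* b)) refl y (pow y (suc n)) (pow (1# - y) (suc n)) ⟩
    pow y (suc (suc (suc n))) - pow (1# - y) (suc (suc (suc n))) ∎
    where
    L t : Carrier
    L = two * y - 1#
    t = - (y * (1# - y))

  dickson3-quadratic : ∀ n y → 1 ≤ n → (two * y - 1#) * Dickson3 n 1# (y * (1# - y)) ≈ pow y n - pow (1# - y) n
  dickson3-quadratic (suc zero) y _ = trans (*-congˡ (dickson3-1 (y * (1# - y))))
    (solve 1 (λ y → (:2 :* y :- :1) :* :1 := y :* :1 :- (:1 :- y) :* :1) refl y)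
  dickson3-quadratic (suc (suc m)) y _ = begin
    L * Dickson3 (suc (suc m)) 1# x                         ≈⟨ *-congˡ (dickson3-fibonacci m x) ⟩
    L * (fibonacci (suc (suc m)) (- x) + x * fibonacci m (- x)) ≈⟨ solve 4 (λ l a x b → l :* (a :+ x :* b) := l :* a :+ x :* (l :* b)) refl L _ x _ ⟩
    L * fibonacci (suc (suc m)) (- x) + x * (L * fibonacci m (- x)) ≈⟨ +-cong (fibonacci-quadratic (suc (suc m)) y) (*-congˡ (fibonacci-quadratic m y)) ⟩
    (pow y (suc (suc (suc m))) - pow (1# - y) (suc (suc (suc m)))) + x * (pow y (suc m) - pow (1# - y) (suc m))
      ≈⟨ solve 3 (λ y a b → (y :* (y :* a) :- (:1 :- y) :* ((:1 :- y) :* b)) :+ (y :* (:1 :- y)) :* (a :- b)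
                           := y :* a :- (:1 :- y) :* b) refl y (pow y (suc m)) (pow (1# - y) (suc m)) ⟩
    pow y (suc (suc m)) - pow (1# - y) (suc (suc m)) ∎
    where
    L x : Carrier
    L = two * y - 1#
    x = y * (1# - y)

  quarter : Carrier
  quarter = half * half

  module CharacteristicNot2 (two≉0 : ¬ (two ≈ 0#)) where

    two*half≈1 : two * half ≈ 1#
    two*half≈1 = ⁻¹-inv two two≉0

    1-half≈half : 1# - half ≈ half
    1-half≈half = begin
      1# - half                 ≈⟨ +-congʳ (sym two*half≈1) ⟩
      two * half - half         ≈⟨ solve 1 (λ h → :2 :* h :- h := h) refl half ⟩
      half                      ∎

    quadratic-half : half * (1# - half) ≈ quarter
    quadratic-half = *-congˡ 1-half≈half

    fibonacci-quarter : ∀ n → pow two n * fibonacci n (- quarter) ≈ natCast (suc n)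
    fibonacci-quarter zero = trans (*-identityˡ _) (trans (fibonacci-0 (- quarter)) (sym (+-identityʳ _)))
    fibonacci-quarter (suc zero) = trans (*-cong (*-identityʳ _) (fibonacci-1 (- quarter))) (trans (*-identityʳ _) (+-congˡ (sym (+-identityʳ _))))
    fibonacci-quarter (suc (suc n)) = begin
      (two * (two * P)) * fibonacci (suc (suc n)) t         ≈⟨ *-congˡ (fibonacci-rec n t) ⟩
      (two * (two * P)) * (A + t * B)
        ≈⟨ solve 4 (λ h P A B → (:2 :* (:2 :* P)) :* (A :+ (:- (h :* h)) :* B)
                               := :2 :* ((:2 :* P) :* A) :+ ((:2 :* h) :* (:2 :* h)) :* (:- (P :* B))) refl half P A B ⟩
      two * ((two * P) * A) + ((two * half) * (two * half)) * (- (P * B))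
        ≈⟨ +-cong (*-congˡ (fibonacci-quarter (suc n))) (*-cong (*-cong two*half≈1 two*half≈1) (-‿cong (fibonacci-quarter n))) ⟩
      two * (1# + N) + (1# * 1#) * (- N)
        ≈⟨ solve 1 (λ N → :2 :* (:1 :+ N) :+ (:1 :* :1) :* (:- N) := :1 :+ (:1 :+ N)) refl N ⟩
      1# + (1# + N) ∎
      where
      t P A B N : Carrier
      t = - quarter
      P = pow two n
      A = fibonacci (suc n) t
      B = fibonacci n t
      N = natCast (suc n)

    dickson3-quarter : ∀ n → 1 ≤ n → Dickson3 n 1# quarter ≈ nOver2pow n
    dickson3-quarter (suc zero) _ = trans (dickson3-1 quarter)
      (sym (trans (*-congʳ (+-identityʳ 1#)) (trans (*-identityˡ _) (sym (⁻¹-unique (*-identityˡ 1#))))))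
    dickson3-quarter (suc (suc m)) _ = begin
      Dickson3 (suc (suc m)) 1# quarter  ≈⟨ dickson3-fibonacci m quarter ⟩
      X                                  ≈⟨ sym (x≈z*y⇒x*y⁻¹≈z (pow-≉0 (suc m) two≉0) (sym X*2ᵐ⁺¹≈m+2)) ⟩
      nOver2pow (suc (suc m))            ∎
      where
      t P A B N X : Carrier
      t = - quarter
      P = pow two m
      A = fibonacci (suc (suc m)) t
      B = fibonacci m t
      N = natCast (suc m)
      X = A + quarter * B
      X*2ᵐ⁺¹≈m+2 : X * pow two (suc m) ≈ natCast (suc (suc m))
      X*2ᵐ⁺¹≈m+2 = *-cancelˡ two≉0 (begin
        two * ((A + quarter * B) * (two * P))
          ≈⟨ solve 4 (λ h P A B → :2 :* ((A :+ (h :* h) :* B) :* (:2 :* P))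
                                 := (:2 :* (:2 :* P)) :* A :+ ((:2 :* h) :* (:2 :* h)) :* (P :* B)) refl half P A B ⟩
        (two * (two * P)) * A + ((two * half) * (two * half)) * (P * B)
          ≈⟨ +-cong (fibonacci-quarter (suc (suc m))) (*-cong (*-cong two*half≈1 two*half≈1) (fibonacci-quarter m)) ⟩
        (1# + (1# + N)) + (1# * 1#) * N
          ≈⟨ solve 1 (λ N → (:1 :+ (:1 :+ N)) :+ (:1 :* :1) :* N := :2 :* (:1 :+ N)) refl N ⟩
        two * (1# + N) ∎)

  -- Poly m a P: P is a polynomial function of degree at most m whose coefficient of x^m is a.
  data Poly : ℕ → Carrier → (Carrier → Carrier) → Set (c ⊔ ℓ) where
    constant : ∀ {a P} → (∀ x → P x ≈ a) → Poly 0 a P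
    horner : ∀ {m a P} b Q → Poly m a Q → (∀ x → P x ≈ b + x * Q x) → Poly (suc m) a P

  Poly-leading-cong : ∀ {m a a′ P} → a ≈ a′ → Poly m a P → Poly m a′ P
  Poly-leading-cong a≈a′ (constant P≈a) = constant (λ x → trans (P≈a x) a≈a′)
  Poly-leading-cong a≈a′ (horner b Q Q-poly P≈) = horner b Q (Poly-leading-cong a≈a′ Q-poly) P≈

  Poly-suc : ∀ {m a P} → Poly m a P → Poly (suc m) 0# P
  Poly-suc (constant P≈a) = horner _ (λ _ → 0#) (constant (λ _ → refl)) (λ x → trans (P≈a x) (sym (trans (+-congˡ (zeroʳ x)) (+-identityʳ _))))
  Poly-suc (horner b Q Q-poly P≈) = horner b Q (Poly-suc Q-poly) P≈

  Poly-+ : ∀ {m a a′ P P′} → Poly m a P → Poly m a′ P′ → Poly m (a + a′) (λ x → P x + P′ x)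
  Poly-+ (constant P≈a) (constant P′≈a′) = constant (λ x → +-cong (P≈a x) (P′≈a′ x))
  Poly-+ (horner b Q Q-poly P≈) (horner b′ Q′ Q′-poly P′≈) = horner (b + b′) (λ x → Q x + Q′ x) (Poly-+ Q-poly Q′-poly)
    (λ x → trans (+-cong (P≈ x) (P′≈ x))
      (solve 5 (λ b b′ x q q′ → (b :+ x :* q) :+ (b′ :+ x :* q′) := (b :+ b′) :+ x :* (q :+ q′)) refl b b′ x (Q x) (Q′ x)))

  Poly-*ˡ : ∀ {m a P} r → Poly m a P → Poly m (r * a) (λ x → r * P x)
  Poly-*ˡ r (constant P≈a) = constant (λ x → *-congˡ (P≈a x))
  Poly-*ˡ r (horner b Q Q-poly P≈) = horner (r * b) (λ x → r * Q x) (Poly-*ˡ r Q-poly)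
    (λ x → trans (*-congˡ (P≈ x)) (solve 4 (λ r b x q → r :* (b :+ x :* q) := r :* b :+ x :* (r :* q)) refl r b x (Q x)))

  Poly-divide : ∀ {m a P} → Poly (suc m) a P → ∀ r → ∃[ Q ] (Poly m a Q × (∀ x → P x - P r ≈ (x - r) * Q x))
  Poly-divide {zero} {a} {P} (horner b Q (constant Q≈a) P≈) r = (λ _ → a) , constant (λ _ → refl) , λ x → begin
    P x - P r                 ≈⟨ +-cong (trans (P≈ x) (+-congˡ (*-congˡ (Q≈a x)))) (-‿cong (trans (P≈ r) (+-congˡ (*-congˡ (Q≈a r))))) ⟩
    (b + x * a) - (b + r * a) ≈⟨ solve 4 (λ b x r a → (b :+ x :* a) :- (b :+ r :* a) := (x :- r) :* a) refl b x r a ⟩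
    (x - r) * a               ∎
  Poly-divide {suc m} {a} {P} (horner b Q Q-poly P≈) r with Poly-divide Q-poly r
  ... | Q′ , Q′-poly , Q-Qr≈ = (λ x → Q x + r * Q′ x)
      , Poly-leading-cong (+-identityʳ a) (Poly-+ Q-poly (Poly-suc (Poly-*ˡ r Q′-poly))) , λ x → begin
    P x - P r                                ≈⟨ +-cong (P≈ x) (-‿cong (P≈ r)) ⟩
    (b + x * Q x) - (b + r * Q r)            ≈⟨ solve 5 (λ b x r q qr → (b :+ x :* q) :- (b :+ r :* qr) := (x :- r) :* q :+ r :* (q :- qr)) refl b x r (Q x) (Q r) ⟩
    (x - r) * Q x + r * (Q x - Q r)          ≈⟨ +-congˡ (*-congˡ (Q-Qr≈ x)) ⟩
    (x - r) * Q x + r * ((x - r) * Q′ x)     ≈⟨ solve 4 (λ x r q q′ → (x :- r) :* q :+ r :* ((x :- r) :* q′) := (x :- r) :* (q :+ r :* q′)) refl x r (Q x) (Q′ x) ⟩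
    (x - r) * (Q x + r * Q′ x)               ∎

  roots-bound : ∀ {m a P rs} → Poly m a P → ¬ (a ≈ 0#) → Unique rs → All (λ r → P r ≈ 0#) rs → length rs ≤ m
  roots-bound {rs = []} _ _ _ _ = z≤n
  roots-bound {zero} {rs = r ∷ _} (constant P≈a) a≉0 _ (Pr≈0 ∷ _) = ⊥-elim (a≉0 (trans (sym (P≈a r)) Pr≈0))
  roots-bound {suc m} {P = P} {rs = r ∷ rs} P-poly a≉0 (r≉rs ∷ rs!) (Pr≈0 ∷ Prs≈0) with Poly-divide P-poly r
  ... | Q , Q-poly , P-Pr≈ = s≤s (roots-bound Q-poly a≉0 rs! (All.zipWith Qs≈0 (r≉rs , Prs≈0)))
    where
    Qs≈0 : ∀ {s} → ¬ (r ≈ s) × P s ≈ 0# → Q s ≈ 0#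
    Qs≈0 {s} (r≉s , Ps≈0) = *-cancelˡ (λ s-r≈0 → r≉s (sym (x-y≈0⇒x≈y s-r≈0)))
      (trans (sym (P-Pr≈ s)) (trans (x≈y⇒x-y≈0 (trans Ps≈0 (sym Pr≈0))) (sym (zeroʳ _))))

  pow-roots-bound : ∀ m b {rs} → Unique rs → All (λ r → pow r (suc m) ≈ b) rs → length rs ≤ suc m
  pow-roots-bound m b rs! rs-roots = roots-bound (x^m-b m) 1≉0 rs! (All.map x≈y⇒x-y≈0 rs-roots)
    where
    x^m : ∀ m → Poly m 1# (λ x → pow x m)
    x^m zero = constant (λ _ → refl)
    x^m (suc m) = horner 0# (λ x → pow x m) (x^m m) (λ _ → sym (+-identityˡ _))
    const : ∀ m → Poly (suc m) 0# (λ _ → - b)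
    const zero = Poly-suc (constant (λ _ → refl))
    const (suc m) = Poly-suc (const m)
    x^m-b : ∀ m → Poly (suc m) 1# (λ x → pow x (suc m) - b)
    x^m-b m = Poly-leading-cong (+-identityʳ 1#) (Poly-+ (x^m (suc m)) (const m))

  quadratic-resp : ∀ {y₁ y₂} → y₁ ≈ y₂ ⊎ y₁ ≈ 1# - y₂ → y₁ * (1# - y₁) ≈ y₂ * (1# - y₂)
  quadratic-resp (inj₁ y₁≈y₂) = *-cong y₁≈y₂ (+-congˡ (-‿cong y₁≈y₂))
  quadratic-resp {y₂ = y₂} (inj₂ y₁≈1-y₂) = trans (*-cong y₁≈1-y₂ (+-congˡ (-‿cong y₁≈1-y₂)))
    (solve 1 (λ y → (:1 :- y) :* (:1 :- (:1 :- y)) := y :* (:1 :- y)) refl y₂)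

  module DecidableEquality (_≟_ : (x y : Carrier) → Dec (x ≈ y)) where

    *≈0⇒ : ∀ {x y} → x * y ≈ 0# → x ≈ 0# ⊎ y ≈ 0#
    *≈0⇒ {x} {y} xy≈0 with x ≟ 0#
    ... | yes x≈0 = inj₁ x≈0
    ... | no x≉0 = inj₂ (*-cancelˡ x≉0 (trans xy≈0 (sym (zeroʳ x))))

    quadratic-≈⇒ : ∀ {y₁ y₂} → y₁ * (1# - y₁) ≈ y₂ * (1# - y₂) → y₁ ≈ y₂ ⊎ y₁ ≈ 1# - y₂
    quadratic-≈⇒ {y₁} {y₂} θy₁≈θy₂ = Sum.map x-y≈0⇒x≈y (λ 1-y₂-y₁≈0 → sym (x-y≈0⇒x≈y 1-y₂-y₁≈0))
      (*≈0⇒ (trans (factorisation y₁ y₂) (x≈y⇒x-y≈0 θy₁≈θy₂)))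
      where
      factorisation : ∀ a b → (a - b) * ((1# - b) - a) ≈ a * (1# - a) - b * (1# - b)
      factorisation = solve 2 (λ a b → (a :- b) :* ((:1 :- b) :- a) := a :* (:1 :- a) :- b :* (:1 :- b)) refl

module UniqueLists {a ℓ} (S : DecSetoid a ℓ) where
  open DecSetoid S renaming (Carrier to A)
  open import Data.List.Membership.Setoid setoid public using (_∈_)
  open import Data.List.Membership.Setoid.Properties public using (∈-∃++; ∈-map⁻; ∈-map⁺; ∈-filter⁺; ∈-resp-≈; ∈-tabulate⁺; All[≉]⇒∉; ∉⇒All[≉])
  open import Data.List.Relation.Unary.Unique.Setoid setoid public using (Unique; head; tail)
  import Data.List.Relation.Unary.Unique.Setoid.Properties as Unique
  open import Data.List.Relation.Binary.Permutation.Setoid setoid public using (_↭_; ↭-refl; ↭-trans; ↭-sym; prep; ↭-reflexive-≋)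
  open import Data.List.Relation.Binary.Permutation.Setoid.Properties setoid public
    using (shift; ∈-resp-↭; Unique-resp-↭; xs↭ys⇒|xs|≡|ys|; foldr-commMonoid)

  length-filter-∁ : ∀ {p} {P : Pred A p} (P? : Decidable P) xs →
    length xs ≡ length (filter P? xs) ℕ.+ length (filter (∁? P?) xs)
  length-filter-∁ P? [] = ≡.refl
  length-filter-∁ P? (x ∷ xs) with P? x
  ... | yes _ = ≡.cong suc (length-filter-∁ P? xs)
  ... | no _ = ≡.trans (≡.cong suc (length-filter-∁ P? xs)) (≡.sym (ℕ.+-suc _ _))

  fibres-bound : ∀ (f : A → A) k I {xs} → Unique xs → All (λ x → f x ∈ I) xs →
    (∀ b {ys} → Unique ys → All (λ y → f y ≈ b) ys → length ys ≤ k) → length xs ≤ k ℕ.* length I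
  fibres-bound f k [] {[]} _ _ _ = z≤n
  fibres-bound f k [] {x ∷ xs} _ (() ∷ _) _
  fibres-bound f k (b ∷ I) {xs} xs! fxs∈bI fibre≤k = begin
    length xs                                           ≡⟨ length-filter-∁ P? xs ⟩
    length (filter P? xs) ℕ.+ length (filter (∁? P?) xs) ≤⟨ ℕ.+-mono-≤ fibre rest ⟩
    k ℕ.+ k ℕ.* length I                                ≡⟨ ℕ.*-suc k (length I) ⟨
    k ℕ.* length (b ∷ I)                                ∎
    where
    open ℕ.≤-Reasoning
    P? : Decidable (λ x → f x ≈ b)
    P? x = f x ≟ b
    fibre : length (filter P? xs) ≤ k
    fibre = fibre≤k b (Unique.filter⁺ setoid P? xs!) (All.all-filter P? xs)
    fx∈I : ∀ {x} → f x ∈ b ∷ I × ¬ (f x ≈ b) → f x ∈ I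
    fx∈I (here fx≈b , fx≉b) = ⊥-elim (fx≉b fx≈b)
    fx∈I (there fx∈I , _) = fx∈I
    rest : length (filter (∁? P?) xs) ≤ k ℕ.* length I
    rest = fibres-bound f k I (Unique.filter⁺ setoid (∁? P?) xs!)
      (All.zipWith fx∈I (All.filter⁺ (∁? P?) fxs∈bI , All.all-filter (∁? P?) xs)) fibre≤k

  unique-⊆⇒length≤ : ∀ {xs ys} → Unique xs → All (_∈ ys) xs → length xs ≤ length ys
  unique-⊆⇒length≤ {xs} {ys} xs! xs⊆ys =
    ℕ.≤-trans (fibres-bound (λ x → x) 1 ys xs! xs⊆ys atMostOne) (ℕ.≤-reflexive (ℕ.*-identityˡ _))
    where
    atMostOne : ∀ b {zs} → Unique zs → All (_≈ b) zs → length zs ≤ 1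
    atMostOne b {[]} _ _ = z≤n
    atMostOne b {_ ∷ []} _ _ = s≤s z≤n
    atMostOne b {_ ∷ _ ∷ _} ((z≉z′ ∷ _) ∷ _) (z≈b ∷ z′≈b ∷ _) = ⊥-elim (z≉z′ (trans z≈b (sym z′≈b)))

  map-unique : ∀ {p} {P : Pred A p} (f : A → A) → (∀ {x y} → P x → P y → f x ≈ f y → x ≈ y) →
    ∀ {xs} → All P xs → Unique xs → Unique (map f xs)
  map-unique f inj {[]} [] [] = []
  map-unique f inj {x ∷ xs} (px ∷ pxs) (x≉xs ∷ xs!) =
    All.map⁺ (All.zipWith (λ (x≉y , py) fx≈fy → x≉y (inj px py fx≈fy)) (x≉xs , pxs)) ∷ map-unique f inj pxs xs!

  record Enumerates {p} (P : Pred A p) (xs : List A) : Set (a ⊔ ℓ ⊔ p) where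
    field
      unique : Unique xs
      sound : All P xs
      complete : ∀ {x} → P x → x ∈ xs

  filter-enumerates : ∀ {q} {Q : Pred A q} {xs} → Unique xs → (∀ x → x ∈ xs) →
    (∀ {x y} → x ≈ y → Q x → Q y) → (Q? : Decidable Q) → Enumerates Q (filter Q? xs)
  filter-enumerates {xs = xs} xs! xs-complete Q-resp Q? = record
    { unique = Unique.filter⁺ setoid Q? xs!
    ; sound = All.all-filter Q? xs
    ; complete = λ {x} qx → ∈-filter⁺ setoid Q? Q-resp (xs-complete x) qx }

  injective⇒surjective : ∀ {p} {P : Pred A p} {xs} → (∀ {x y} → x ≈ y → P x → P y) → Enumerates P xs →
    (f : A → A) → (∀ {x} → P x → P (f x)) → (∀ {x y} → P x → P y → f x ≈ f y → x ≈ y) →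
    ∀ {z} → P z → ∃[ x ] (P x × f x ≈ z)
  injective⇒surjective {P = P} {xs} P-resp P-enum f f-closed f-inj {z} pz = from-dec (any? (z ≟_) (map f xs))
    where
    open Enumerates P-enum
    from-dec : Dec (z ∈ map f xs) → ∃[ x ] (P x × f x ≈ z)
    from-dec (yes z∈fxs) = let x , x∈xs , z≈fx = ∈-map⁻ setoid setoid z∈fxs in
      x , All.lookupₛ setoid P-resp sound x∈xs , sym z≈fx
    from-dec (no z∉fxs) = ⊥-elim (ℕ.<-irrefl (List.length-map f xs) (unique-⊆⇒length≤ z∷fxs! (complete pz ∷ fxs⊆xs)))
      where
      z∷fxs! : Unique (z ∷ map f xs)
      z∷fxs! = ∉⇒All[≉] setoid z∉fxs ∷ map-unique f f-inj sound unique
      fxs⊆xs : All (_∈ xs) (map f xs)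
      fxs⊆xs = All.map⁺ (All.map (complete ∘ f-closed) sound)

  same-members⇒↭ : ∀ {xs ys} → Unique xs → Unique ys →
    (∀ {w} → w ∈ xs → w ∈ ys) → (∀ {w} → w ∈ ys → w ∈ xs) → xs ↭ ys
  same-members⇒↭ {[]} {[]} _ _ _ _ = ↭-refl
  same-members⇒↭ {[]} {_ ∷ _} _ _ _ ys⊆xs with ys⊆xs (here refl)
  ... | ()
  same-members⇒↭ {x ∷ xs} {ys} (x≉xs ∷ xs!) ys! xs⊆ys ys⊆xs with ∈-∃++ setoid (xs⊆ys (here refl))
  ... | ws , zs , w , x≈w , ys≋ = ↭-trans (prep x≈w (same-members⇒↭ xs! (tail w∷rest!) xs⊆rest rest⊆xs)) (↭-sym ys↭)
    where
    ys↭ : ys ↭ w ∷ ws ++ zs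
    ys↭ = ↭-trans (↭-reflexive-≋ ys≋) (shift refl ws zs)
    w∷rest! : Unique (w ∷ ws ++ zs)
    w∷rest! = Unique-resp-↭ ys↭ ys!
    xs⊆rest : ∀ {u} → u ∈ xs → u ∈ ws ++ zs
    xs⊆rest u∈xs with ∈-resp-↭ ys↭ (xs⊆ys (there u∈xs))
    ... | here u≈w = ⊥-elim (All[≉]⇒∉ setoid x≉xs (∈-resp-≈ setoid (trans u≈w (sym x≈w)) u∈xs))
    ... | there u∈rest = u∈rest
    rest⊆xs : ∀ {u} → u ∈ ws ++ zs → u ∈ xs
    rest⊆xs u∈rest with ys⊆xs (∈-resp-↭ (↭-sym ys↭) (there u∈rest))
    ... | here u≈x = ⊥-elim (All[≉]⇒∉ setoid (head w∷rest!) (∈-resp-≈ setoid (trans u≈x x≈w) u∈rest))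
    ... | there u∈xs = u∈xs

module Frobenius {c ℓ} (R : CommutativeRing c ℓ) (isF : IsField R)
    {p} (p-prime : Prime p) (p≈0 : CommutativeRing._≈_ R (FieldDefs.natCast R isF p) (CommutativeRing.0# R)) where
  open FieldLemmas R isF
  open import Algebra.Properties.CommutativeSemiring.Binomial commutativeSemiring using (binomialTerm)
    renaming (theorem to binomial-theorem)
  open import Algebra.Properties.Semiring.Exp semiring using (_^_)
  open import Algebra.Properties.Semiring.Mult semiring using () renaming (_×_ to _·_)
  open import Algebra.Properties.Semiring.Sum semiring using (sum)
  open import Data.Fin.Base as Fin using (toℕ; fromℕ)
  open import Data.Fin.Properties using (toℕ-fromℕ)

  natCast-∣ : ∀ {m} → p ∣ m → natCast m ≈ 0#
  natCast-∣ {m} (divides k ≡.refl) = trans (natCast-* k p) (trans (*-congˡ p≈0) (zeroʳ _))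

  pow≈^ : ∀ x n → pow x n ≈ x ^ n
  pow≈^ x zero = refl
  pow≈^ x (suc n) = *-congˡ (pow≈^ x n)

  ·≈natCast* : ∀ n x → n · x ≈ natCast n * x
  ·≈natCast* zero x = sym (zeroˡ x)
  ·≈natCast* (suc n) x = trans (+-cong (sym (*-identityˡ x)) (·≈natCast* n x)) (sym (distribʳ _ _ _))

  sum-last : ∀ m (t : Fin (suc m) → Carrier) → (∀ i → toℕ i < m → t i ≈ 0#) → sum t ≈ t (fromℕ m)
  sum-last zero t _ = +-identityʳ _
  sum-last (suc m) t t≈0 = trans (+-cong (t≈0 Fin.zero (s≤s z≤n)) (sum-last m (t ∘ Fin.suc) (λ i i<m → t≈0 (Fin.suc i) (s≤s i<m))))
    (+-identityˡ _)

  -- The middle binomial coefficients C(p, i), 0 < i < p, are divisible by p and so vanish in R.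
  frobenius : ∀ x y → pow (x + y) p ≈ pow x p + pow y p
  frobenius x y = frobenius′ p ≡.refl
    where
    frobenius′ : ∀ n → n ≡ p → pow (x + y) n ≈ pow x n + pow y n
    frobenius′ zero ≡.refl = ⊥-elim (ℕ.<⇒≱ (ℕ.nonTrivial⇒n>1 0 {{prime⇒nonTrivial p-prime}}) z≤n)
    frobenius′ (suc r) ≡.refl = begin
      pow (x + y) (suc r)                  ≈⟨ pow≈^ (x + y) (suc r) ⟩
      (x + y) ^ suc r                      ≈⟨ binomial-theorem (suc r) x y ⟩
      term Fin.zero + sum (term ∘ Fin.suc) ≈⟨ +-congˡ (sum-last r (term ∘ Fin.suc) middle≈0) ⟩
      term Fin.zero + term (fromℕ (suc r)) ≈⟨ +-cong (trans (+-identityʳ _) (trans (*-identityˡ _) (sym (pow≈^ y (suc r))))) last ⟩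
      pow y (suc r) + pow x (suc r)        ≈⟨ +-comm _ _ ⟩
      pow x (suc r) + pow y (suc r)        ∎
      where
      term : Fin (suc (suc r)) → Carrier
      term = binomialTerm x y (suc r)
      middle≈0 : ∀ i → toℕ i < r → term (Fin.suc i) ≈ 0#
      middle≈0 i i<r = trans (·≈natCast* (suc r C suc (toℕ i)) _)
        (trans (*-congʳ (natCast-∣ (prime∣binomial p-prime (s≤s z≤n) (s≤s i<r)))) (zeroˡ _))
      last : term (fromℕ (suc r)) ≈ pow x (suc r)
      last = begin
        (suc r C toℕ (fromℕ (suc r))) · ((x ^ toℕ (fromℕ (suc r))) * (y ^ (suc r ∸ toℕ (fromℕ (suc r)))))
          ≡⟨ ≡.cong (λ i → (suc r C i) · ((x ^ i) * (y ^ (suc r ∸ i)))) (toℕ-fromℕ (suc r)) ⟩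
        (suc r C suc r) · ((x ^ suc r) * (y ^ (suc r ∸ suc r)))
          ≡⟨ ≡.cong₂ (λ a b → a · ((x ^ suc r) * (y ^ b))) (nCn≡1 (suc r)) (ℕ.n∸n≡0 (suc r)) ⟩
        (x ^ suc r) * 1# + 0#  ≈⟨ trans (+-identityʳ _) (trans (*-identityʳ _) (sym (pow≈^ x (suc r)))) ⟩
        pow x (suc r)          ∎

  frobenius^ : ∀ k x y → pow (x + y) (p ℕ.^ k) ≈ pow x (p ℕ.^ k) + pow y (p ℕ.^ k)
  frobenius^ zero x y = trans (*-identityʳ _) (sym (+-cong (*-identityʳ _) (*-identityʳ _)))
  frobenius^ (suc k) x y = begin
    pow (x + y) (p ℕ.* p ℕ.^ k)                          ≈⟨ pow-* (x + y) p (p ℕ.^ k) ⟩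
    pow (pow (x + y) p) (p ℕ.^ k)                        ≈⟨ pow-cong (p ℕ.^ k) (frobenius x y) ⟩
    pow (pow x p + pow y p) (p ℕ.^ k)                    ≈⟨ frobenius^ k (pow x p) (pow y p) ⟩
    pow (pow x p) (p ℕ.^ k) + pow (pow y p) (p ℕ.^ k)    ≈⟨ sym (+-cong (pow-* x p (p ℕ.^ k)) (pow-* y p (p ℕ.^ k))) ⟩
    pow x (p ℕ.* p ℕ.^ k) + pow y (p ℕ.* p ℕ.^ k)        ∎

  module Subfield {k q} (q≡p^k : q ≡ p ℕ.^ k) where

    pow-q-+ : ∀ x y → pow (x + y) q ≈ pow x q + pow y q
    pow-q-+ x y rewrite q≡p^k = frobenius^ k x y

    pow-q-0 : pow 0# q ≈ 0#
    pow-q-0 = begin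
      pow 0# q                          ≈⟨ solve 1 (λ a → a := (a :+ a) :- a) refl (pow 0# q) ⟩
      (pow 0# q + pow 0# q) - pow 0# q  ≈⟨ +-congʳ (sym (trans (pow-cong q (sym (+-identityʳ 0#))) (pow-q-+ 0# 0#))) ⟩
      pow 0# q - pow 0# q               ≈⟨ -‿inverseʳ _ ⟩
      0#                                ∎

    pow-q-‿ : ∀ x → pow (- x) q ≈ - pow x q
    pow-q-‿ x = begin
      pow (- x) q                            ≈⟨ solve 2 (λ a b → b := (:- a) :+ (a :+ b)) refl (pow x q) (pow (- x) q) ⟩
      - pow x q + (pow x q + pow (- x) q)    ≈⟨ +-congˡ (sym (pow-q-+ x (- x))) ⟩
      - pow x q + pow (x - x) q              ≈⟨ +-congˡ (trans (pow-cong q (-‿inverseʳ x)) pow-q-0) ⟩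
      - pow x q + 0#                         ≈⟨ +-identityʳ _ ⟩
      - pow x q                              ∎

    pow-q-quadratic : ∀ y → pow (y * (1# - y)) q ≈ pow y q * (1# - pow y q)
    pow-q-quadratic y = trans (pow-distrib-* y (1# - y) q) (*-congˡ (trans (pow-q-+ 1# (- y)) (+-cong (pow-1# q) (pow-q-‿ y))))

    quadratic∈Fq : ∀ {y} → InFq q y ⊎ InV q y → InFq q (y * (1# - y))
    quadratic∈Fq {y} y∈Fq∪V = trans (pow-q-quadratic y) (quadratic-resp y∈Fq∪V)

    InFq-resp : ∀ {x y} → x ≈ y → InFq q x → InFq q y
    InFq-resp x≈y x∈Fq = trans (pow-cong q (sym x≈y)) (trans x∈Fq x≈y)

    InFq-+ : ∀ {x y} → InFq q x → InFq q y → InFq q (x + y)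
    InFq-+ x∈Fq y∈Fq = trans (pow-q-+ _ _) (+-cong x∈Fq y∈Fq)

    InFq-* : ∀ {x y} → InFq q x → InFq q y → InFq q (x * y)
    InFq-* x∈Fq y∈Fq = trans (pow-distrib-* _ _ q) (*-cong x∈Fq y∈Fq)

    InFq-‿ : ∀ {x} → InFq q x → InFq q (- x)
    InFq-‿ x∈Fq = trans (pow-q-‿ _) (-‿cong x∈Fq)

    InFq-1 : InFq q 1#
    InFq-1 = pow-1# q

    InFq-natCast : ∀ m → InFq q (natCast m)
    InFq-natCast zero = pow-q-0
    InFq-natCast (suc m) = InFq-+ InFq-1 (InFq-natCast m)

    InFq-pow : ∀ {x} n → InFq q x → InFq q (pow x n)
    InFq-pow zero _ = InFq-1
    InFq-pow (suc n) x∈Fq = InFq-* x∈Fq (InFq-pow n x∈Fq)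

    InFq-⁻¹ : ∀ {x} → ¬ (x ≈ 0#) → InFq q x → InFq q (x ⁻¹)
    InFq-⁻¹ {x} x≉0 x∈Fq = ⁻¹-unique (begin
      x * pow (x ⁻¹) q        ≈⟨ *-congʳ (sym x∈Fq) ⟩
      pow x q * pow (x ⁻¹) q  ≈⟨ sym (pow-distrib-* _ _ q) ⟩
      pow (x * x ⁻¹) q        ≈⟨ pow-cong q (⁻¹-inv x x≉0) ⟩
      pow 1# q                ≈⟨ pow-1# q ⟩
      1#                      ∎)

    InFq-sumTo : ∀ (f : ℕ → Carrier) m → (∀ i → InFq q (f i)) → InFq q (sumTo f m)
    InFq-sumTo f zero _ = pow-q-0
    InFq-sumTo f (suc m) f∈Fq = InFq-+ (f∈Fq 0) (InFq-sumTo (f ∘ suc) m (f∈Fq ∘ suc))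

    InFq-dickson3 : ∀ n {x} → InFq q x → InFq q (Dickson3 n 1# x)
    InFq-dickson3 n {x} x∈Fq = ≡.subst (InFq q) (≡.sym (sumR-applyUpTo term (λ i → i) (suc ⌊ n /2⌋)))
      (InFq-sumTo term (suc ⌊ n /2⌋) (λ i → InFq-* (InFq-coeff i) (InFq-* (InFq-pow i (InFq-‿ x∈Fq)) (InFq-pow (n ∸ 2 ℕ.* i) InFq-1))))
      where
      term : ℕ → Carrier
      term i = coeff n i * (pow (- x) i * pow 1# (n ∸ 2 ℕ.* i))
      InFq-coeff : ∀ i → InFq q (coeff n i)
      InFq-coeff zero = InFq-natCast ((n ∸ 0) C 0)
      InFq-coeff (suc j) = InFq-+ (InFq-natCast ((n ∸ suc j) C suc j)) (InFq-‿ (InFq-natCast ((n ∸ suc j ∸ 1) C j)))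

module FiniteField {c ℓ} (R : CommutativeRing c ℓ) (isF : IsField R) {N}
    (enumeration : Bijection (CommutativeRing.setoid R) (≡.setoid (Fin N))) where
  open FieldLemmas R isF
  open Bijection enumeration using (to; injective) renaming (cong to to-cong)
  open Inverse (Bijection⇒Inverse enumeration) using (from; strictlyInverseˡ; strictlyInverseʳ)

  _≟_ : (x y : Carrier) → Dec (x ≈ y)
  x ≟ y = map′ injective to-cong (to x Fin.≟ to y)

  decSetoid : DecSetoid c ℓ
  decSetoid = record { isDecEquivalence = record { isEquivalence = isEquivalence ; _≟_ = _≟_ } }

  open UniqueLists decSetoid public
  open DecidableEquality _≟_ public
  import Data.List.Relation.Unary.Unique.Setoid.Properties as Unique

  elements : List Carrier
  elements = tabulate from

  elements-unique : Unique elements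
  elements-unique = Unique.tabulate⁺ setoid λ {i} {j} fi≈fj →
    ≡.trans (≡.sym (strictlyInverseˡ i)) (≡.trans (to-cong fi≈fj) (strictlyInverseˡ j))

  ∈-elements : ∀ x → x ∈ elements
  ∈-elements x = ∈-resp-≈ setoid (strictlyInverseʳ x) (∈-tabulate⁺ setoid (to x))

  filter-elements : ∀ {q} {Q : Pred Carrier q} → (∀ {x y} → x ≈ y → Q x → Q y) → (Q? : Decidable Q) →
    Enumerates Q (filter Q? elements)
  filter-elements = filter-enumerates elements-unique ∈-elements

  nonzero : List Carrier
  nonzero = filter (λ x → ¬? (x ≟ 0#)) elements

  ≉0-resp : ∀ {x y} → x ≈ y → ¬ (x ≈ 0#) → ¬ (y ≈ 0#)
  ≉0-resp x≈y x≉0 y≈0 = x≉0 (trans x≈y y≈0)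

  nonzero-enumerates : Enumerates (λ x → ¬ (x ≈ 0#)) nonzero
  nonzero-enumerates = filter-elements ≉0-resp (λ x → ¬? (x ≟ 0#))

  N≡1+length-nonzero : N ≡ suc (length nonzero)
  N≡1+length-nonzero = ≡.trans (≡.sym (List.length-tabulate from))
    (xs↭ys⇒|xs|≡|ys| (same-members⇒↭ elements-unique 0∷nonzero-unique (λ {w} _ → w∈0∷nonzero w) (λ {w} _ → ∈-elements w)))
    where
    open Enumerates nonzero-enumerates
    0∷nonzero-unique : Unique (0# ∷ nonzero)
    0∷nonzero-unique = All.map (λ x≉0 0≈x → x≉0 (sym 0≈x)) sound ∷ unique
    w∈0∷nonzero : ∀ w → w ∈ 0# ∷ nonzero
    w∈0∷nonzero w with w ≟ 0#
    ... | yes w≈0 = here w≈0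
    ... | no w≉0 = there (complete w≉0)

  product : List Carrier → Carrier
  product = foldr _*_ 1#

  product-map-*ˡ : ∀ a xs → product (map (a *_) xs) ≈ pow a (length xs) * product xs
  product-map-*ˡ a [] = sym (*-identityˡ _)
  product-map-*ˡ a (x ∷ xs) = trans (*-congˡ (product-map-*ˡ a xs))
    (solve 4 (λ a x p q → (a :* x) :* (p :* q) := (a :* p) :* (x :* q)) refl a x (pow a (length xs)) (product xs))

  product-≉0 : ∀ {xs} → All (λ x → ¬ (x ≈ 0#)) xs → ¬ (product xs ≈ 0#)
  product-≉0 [] = 1≉0
  product-≉0 (x≉0 ∷ xs≉0) = *-≉0 x≉0 (product-≉0 xs≉0)

  -- Multiplication by a ≠ 0 permutes the nonzero elements, so it leaves their product unchanged.
  pow-length-nonzero : ∀ {a} → ¬ (a ≈ 0#) → pow a (length nonzero) ≈ 1#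
  pow-length-nonzero {a} a≉0 = *-cancelˡ (product-≉0 sound) (begin
    product nonzero * pow a (length nonzero)  ≈⟨ *-comm _ _ ⟩
    pow a (length nonzero) * product nonzero  ≈⟨ product-map-*ˡ a nonzero ⟨
    product (map (a *_) nonzero)              ≈⟨ foldr-commMonoid *-isCommutativeMonoid a*nonzero↭nonzero ⟩
    product nonzero                           ≈⟨ *-identityʳ _ ⟨
    product nonzero * 1#                      ∎)
    where
    open Enumerates nonzero-enumerates
    a*nonzero⊆nonzero : ∀ {w} → w ∈ map (a *_) nonzero → w ∈ nonzero
    a*nonzero⊆nonzero w∈ with ∈-map⁻ setoid setoid w∈
    ... | x , x∈ , w≈ax = complete (≉0-resp (sym w≈ax) (*-≉0 a≉0 (All.lookupₛ setoid ≉0-resp sound x∈)))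
    nonzero⊆a*nonzero : ∀ {w} → w ∈ nonzero → w ∈ map (a *_) nonzero
    nonzero⊆a*nonzero {w} w∈ = ∈-resp-≈ setoid a*[a⁻¹*w]≈w
      (∈-map⁺ setoid setoid *-congˡ (complete (*-≉0 (⁻¹-≉0 a≉0) (All.lookupₛ setoid ≉0-resp sound w∈))))
      where
      a*[a⁻¹*w]≈w : a * (a ⁻¹ * w) ≈ w
      a*[a⁻¹*w]≈w = trans (sym (*-assoc _ _ _)) (trans (*-congʳ (⁻¹-inv a a≉0)) (*-identityˡ w))
    a*nonzero↭nonzero : map (a *_) nonzero ↭ nonzero
    a*nonzero↭nonzero = same-members⇒↭ (map-unique (a *_) (λ _ _ → *-cancelˡ a≉0) sound unique) unique
      a*nonzero⊆nonzero nonzero⊆a*nonzero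

  fermat : ∀ z → pow z N ≈ z
  fermat z rewrite N≡1+length-nonzero with z ≟ 0#
  ... | yes z≈0 = trans (*-congʳ z≈0) (trans (zeroˡ _) (sym z≈0))
  ... | no z≉0 = trans (*-congˡ (pow-length-nonzero z≉0)) (*-identityʳ z)

module OddCharacteristic {c ℓ} (R : CommutativeRing c ℓ) (isF : IsField R)
    {p k q} (p-prime : Prime p) (p≢2 : p ≢ 2) (1≤k : 1 ≤ k) (q≡p^k : q ≡ p ℕ.^ k)
    (p≈0 : CommutativeRing._≈_ R (FieldDefs.natCast R isF p) (CommutativeRing.0# R))
    (enumeration : Bijection (CommutativeRing.setoid R) (≡.setoid (Fin (q ℕ.* q)))) where
  open FieldLemmas R isF
  open FiniteField R isF enumeration
  open Frobenius R isF p-prime p≈0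
  open Subfield {k} q≡p^k

  two≉0 : ¬ (two ≈ 0#)
  two≉0 two≈0 with prime≢2⇒odd p-prime p≢2
  ... | m , ≡.refl = 1≉0 (begin
    1#                            ≈⟨ sym (+-identityʳ 1#) ⟩
    1# + 0#                       ≈⟨ +-congˡ (sym (trans (*-congʳ two≈0) (zeroˡ _))) ⟩
    1# + two * natCast m          ≈⟨ +-congˡ (solve 1 (λ x → :2 :* x := x :+ x) refl (natCast m)) ⟩
    1# + (natCast m + natCast m)  ≈⟨ +-congˡ (natCast-+ m m) ⟨
    natCast (suc (m ℕ.+ m))       ≈⟨ p≈0 ⟩
    0#                            ∎)

  open CharacteristicNot2 two≉0

  q≡3+2c : ∃[ c ] q ≡ suc (suc c ℕ.+ suc c)
  q≡3+2c = let c , p^k≡3+2c = oddPrimePower≡3+2c p-prime p≢2 1≤k in c , ≡.trans q≡p^k p^k≡3+2c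

  InFq? : Decidable (InFq q)
  InFq? x = pow x q ≟ x

  Fq-enumerates : Enumerates (InFq q) (filter InFq? elements)
  Fq-enumerates = filter-elements InFq-resp InFq?

  quarter∈Fq : InFq q quarter
  quarter∈Fq = InFq-* half∈Fq half∈Fq
    where
    half∈Fq : InFq q half
    half∈Fq = InFq-⁻¹ two≉0 (InFq-+ InFq-1 InFq-1)

  norm∈Fq : ∀ a → InFq q (pow a (suc q))
  norm∈Fq a = begin
    pow (pow a (suc q)) q     ≈⟨ pow-* a (suc q) q ⟨
    pow a (q ℕ.+ q ℕ.* q)     ≈⟨ pow-+ a q (q ℕ.* q) ⟩
    pow a q * pow a (q ℕ.* q) ≈⟨ *-congˡ (fermat a) ⟩
    pow a q * a               ≈⟨ *-comm _ _ ⟩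
    pow a (suc q)             ∎

  -- Otherwise the q² - 1 nonzero elements would lie in fibres, of size at most q + 1, of the norm a ↦ a^(q+1)
  -- above F_q^* ∖ {D}; with D these are roots of w^(q-1) = 1, so there are at most q - 2 of them.
  norm-surjective : ∀ {D} → InFq q D → ¬ (D ≈ 0#) → ∃[ a ] pow a (suc q) ≈ D
  norm-surjective {D} D∈Fq D≉0 with any? (λ a → pow a (suc q) ≟ D) nonzero
  ... | yes ∃a = Any.satisfied ∃a
  ... | no ∄a = ⊥-elim (ℕ.<⇒≱ ([3+r]*r<[2+r]²-1 r (length nonzero) [2+r]²≡1+|nonzero|) nonzero≤[3+r]*r)
    where
    r : ℕ
    r = proj₁ q≡3+2c ℕ.+ suc (proj₁ q≡3+2c)
    q≡2+r : q ≡ suc (suc r)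
    q≡2+r = proj₂ q≡3+2c
    [2+r]²≡1+|nonzero| : (2 ℕ.+ r) ℕ.* (2 ℕ.+ r) ≡ suc (length nonzero)
    [2+r]²≡1+|nonzero| = ≡.subst (λ m → m ℕ.* m ≡ suc (length nonzero)) q≡2+r N≡1+length-nonzero
    Other : Pred Carrier ℓ
    Other w = InFq q w × ¬ (w ≈ 0#) × ¬ (w ≈ D)
    Other? : Decidable Other
    Other? w = InFq? w ×-dec ¬? (w ≟ 0#) ×-dec ¬? (w ≟ D)
    Other-resp : ∀ {x y} → x ≈ y → Other x → Other y
    Other-resp x≈y (x∈Fq , x≉0 , x≉D) = InFq-resp x≈y x∈Fq , (≉0-resp x≈y x≉0) , (λ y≈D → x≉D (trans x≈y y≈D))
    module NZ = Enumerates nonzero-enumerates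
    module I = Enumerates (filter-elements Other-resp Other?)
    I : List Carrier
    I = filter Other? elements
    nonzero≤[1+q]*|I| : length nonzero ≤ suc q ℕ.* length I
    nonzero≤[1+q]*|I| = fibres-bound (λ a → pow a (suc q)) (suc q) I NZ.unique
      (All.zipWith (λ (a≉0 , Na≉D) → I.complete (norm∈Fq _ , pow-≉0 (suc q) a≉0 , Na≉D)) (NZ.sound , All.¬Any⇒All¬ nonzero ∄a))
      (pow-roots-bound q)
    root-of-unity : ∀ {w} → InFq q w → ¬ (w ≈ 0#) → pow w (suc r) ≈ 1#
    root-of-unity {w} w∈Fq w≉0 = *-cancelˡ w≉0 (trans (trans (pow-cong′ (≡.sym q≡2+r)) w∈Fq) (sym (*-identityʳ w)))
      where
      pow-cong′ : ∀ {m n} → m ≡ n → pow w m ≈ pow w n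
      pow-cong′ m≡n = reflexive (≡.cong (pow w) m≡n)
    D∷I≤1+r : length (D ∷ I) ≤ suc r
    D∷I≤1+r = pow-roots-bound r 1#
      (All.map (λ (_ , _ , w≉D) D≈w → w≉D (sym D≈w)) I.sound ∷ I.unique)
      (root-of-unity D∈Fq D≉0 ∷ All.map (λ (w∈Fq , w≉0 , _) → root-of-unity w∈Fq w≉0) I.sound)
    nonzero≤[3+r]*r : length nonzero ≤ (3 ℕ.+ r) ℕ.* r
    nonzero≤[3+r]*r = ℕ.≤-trans nonzero≤[1+q]*|I|
      (ℕ.≤-trans (ℕ.*-monoʳ-≤ (suc q) (ℕ.≤-pred D∷I≤1+r)) (ℕ.≤-reflexive (≡.cong (λ m → suc m ℕ.* r) q≡2+r)))

  Fq-square : ∀ {D} → InFq q D → ∃[ s ] s * s ≈ D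
  Fq-square {D} D∈Fq with D ≟ 0#
  ... | yes D≈0 = 0# , trans (zeroˡ 0#) (sym D≈0)
  ... | no D≉0 with norm-surjective D∈Fq D≉0 | q≡3+2c
  ...   | a , aᵠ⁺¹≈D | c , q≡3+2c′ = pow a (suc (suc c)) , (begin
    pow a (suc (suc c)) * pow a (suc (suc c))  ≈⟨ pow-+ a (suc (suc c)) (suc (suc c)) ⟨
    pow a (suc (suc c) ℕ.+ suc (suc c))        ≡⟨ ≡.cong (pow a) (≡.trans (≡.cong suc (ℕ.+-suc (suc c) (suc c))) (≡.sym (≡.cong suc q≡3+2c′))) ⟩
    pow a (suc q)                              ≈⟨ aᵠ⁺¹≈D ⟩
    D                                          ∎)

  QuadraticPreimage : Carrier → Set (c ⊔ ℓ)
  QuadraticPreimage x = ∃[ y ] ((InFq q y ⊎ InV q y) × y * (1# - y) ≈ x)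

  -- The root y = (1 + √(1 - 4x)) / 2 of y (1 - y) = x; its conjugate y^q is a root too, so it is y or 1 - y.
  quadratic-surjective : ∀ {x} → InFq q x → QuadraticPreimage x
  quadratic-surjective {x} x∈Fq with Fq-square (InFq-+ InFq-1 (InFq-‿ (InFq-* (InFq-* InFq-2 InFq-2) x∈Fq)))
    where
    InFq-2 : InFq q two
    InFq-2 = InFq-+ InFq-1 InFq-1
  ... | s , s²≈1-4x = y , y∈Fq∪V , θy≈x
    where
    y : Carrier
    y = half * (1# + s)
    θy≈x : y * (1# - y) ≈ x
    θy≈x = begin
      y * (1# - y)
        ≈⟨ solve 2 (λ h s → (h :* (:1 :+ s)) :* (:1 :- h :* (:1 :+ s))
                          := h :* h :* (:1 :- s :* s) :+ h :* (:1 :+ s) :* (:1 :- :2 :* h)) refl half s ⟩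
      half * half * (1# - s * s) + half * (1# + s) * (1# - two * half)
        ≈⟨ +-cong (*-congˡ (+-congˡ (-‿cong s²≈1-4x))) (*-congˡ (+-congˡ (-‿cong two*half≈1))) ⟩
      half * half * (1# - (1# - two * two * x)) + half * (1# + s) * (1# - 1#)
        ≈⟨ solve 3 (λ h s x → h :* h :* (:1 :- (:1 :- :2 :* :2 :* x)) :+ h :* (:1 :+ s) :* (:1 :- :1)
                            := (:2 :* h) :* (:2 :* h) :* x) refl half s x ⟩
      (two * half) * (two * half) * x  ≈⟨ *-congʳ (*-cong two*half≈1 two*half≈1) ⟩
      1# * 1# * x                      ≈⟨ trans (*-congʳ (*-identityˡ 1#)) (*-identityˡ x) ⟩
      x                                ∎
    y∈Fq∪V : InFq q y ⊎ InV q y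
    y∈Fq∪V = quadratic-≈⇒ (trans (sym (pow-q-quadratic y)) (trans (pow-cong q θy≈x) (trans x∈Fq (sym θy≈x))))

  quadratic≈quarter⇒≈half : ∀ {y} → y * (1# - y) ≈ quarter → y ≈ half
  quadratic≈quarter⇒≈half θy≈¼ with quadratic-≈⇒ (trans θy≈¼ (sym quadratic-half))
  ... | inj₁ y≈½ = y≈½
  ... | inj₂ y≈1-½ = trans y≈1-½ 1-half≈half

  module DicksonPermutation {n} (1≤n : 1 ≤ n) where

    F : Carrier → Carrier
    F = Dickson3 n 1#

    g≈F∘quadratic : ∀ {y x} → ¬ (y ≈ half) → y * (1# - y) ≈ x → g n y ≈ F x
    g≈F∘quadratic {y} y≉½ θy≈x = trans (x≈z*y⇒x*y⁻¹≈z 2y-1≉0 (sym (trans (*-comm _ _) (dickson3-quadratic n y 1≤n))))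
      (dickson3-cong n θy≈x)
      where
      2y-1≉0 : ¬ (two * y - 1# ≈ 0#)
      2y-1≉0 2y-1≈0 = y≉½ (⁻¹-unique (x-y≈0⇒x≈y 2y-1≈0))

    F-quarter : ∀ {y x} → y ≈ half → y * (1# - y) ≈ x → F x ≈ nOver2pow n
    F-quarter y≈½ θy≈x = trans (dickson3-cong n (trans (sym θy≈x) (trans (quadratic-resp (inj₁ y≈½)) quadratic-half)))
      (dickson3-quarter n 1≤n)

    TwoToOneAvoiding : Set (c ⊔ ℓ)
    TwoToOneAvoiding = TwoToOneOnS q (g n) × (∀ y → InS q y → ¬ (g n y ≈ nOver2pow n))

    permutation⇒twoToOneAvoiding : IsPermOfFq q F → TwoToOneAvoiding
    permutation⇒twoToOneAvoiding (_ , F-injective , _) = two-to-one , avoids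
      where
      two-to-one : TwoToOneOnS q (g n)
      two-to-one y₁ y₂ (y₁∈ , y₁≉½) (y₂∈ , y₂≉½) =
          (λ gy₁≈gy₂ → quadratic-≈⇒ (F-injective _ _ (quadratic∈Fq y₁∈) (quadratic∈Fq y₂∈)
            (trans (sym (g≈F∘quadratic y₁≉½ refl)) (trans gy₁≈gy₂ (g≈F∘quadratic y₂≉½ refl)))))
        , (λ y₁~y₂ → trans (g≈F∘quadratic y₁≉½ (quadratic-resp y₁~y₂)) (sym (g≈F∘quadratic y₂≉½ refl)))
      avoids : ∀ y → InS q y → ¬ (g n y ≈ nOver2pow n)
      avoids y (y∈ , y≉½) gy≈special = y≉½ (quadratic≈quarter⇒≈half (F-injective _ _ (quadratic∈Fq y∈) quarter∈Fq
        (trans (sym (g≈F∘quadratic y≉½ refl)) (trans gy≈special (sym (F-quarter refl quadratic-half))))))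

    twoToOneAvoiding⇒permutation : TwoToOneAvoiding → IsPermOfFq q F
    twoToOneAvoiding⇒permutation (two-to-one , avoids) = F-closed , F-injective , F-surjective
      where
      F-closed : ∀ x → InFq q x → InFq q (F x)
      F-closed x = InFq-dickson3 n
      F-injective : ∀ x₁ x₂ → InFq q x₁ → InFq q x₂ → F x₁ ≈ F x₂ → x₁ ≈ x₂
      F-injective x₁ x₂ x₁∈Fq x₂∈Fq Fx₁≈Fx₂ = via (quadratic-surjective x₁∈Fq) (quadratic-surjective x₂∈Fq)
        where
        via : QuadraticPreimage x₁ → QuadraticPreimage x₂ → x₁ ≈ x₂
        via (y₁ , y₁∈ , θy₁≈x₁) (y₂ , y₂∈ , θy₂≈x₂) = trans (sym θy₁≈x₁) (trans (θy₁≈θy₂ (y₁ ≟ half) (y₂ ≟ half)) θy₂≈x₂)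
          where
          θy₁≈θy₂ : Dec (y₁ ≈ half) → Dec (y₂ ≈ half) → y₁ * (1# - y₁) ≈ y₂ * (1# - y₂)
          θy₁≈θy₂ (yes y₁≈½) (yes y₂≈½) = quadratic-resp (inj₁ (trans y₁≈½ (sym y₂≈½)))
          θy₁≈θy₂ (yes y₁≈½) (no y₂≉½) = ⊥-elim (avoids y₂ (y₂∈ , y₂≉½)
            (trans (g≈F∘quadratic y₂≉½ θy₂≈x₂) (trans (sym Fx₁≈Fx₂) (F-quarter y₁≈½ θy₁≈x₁))))
          θy₁≈θy₂ (no y₁≉½) (yes y₂≈½) = ⊥-elim (avoids y₁ (y₁∈ , y₁≉½)
            (trans (g≈F∘quadratic y₁≉½ θy₁≈x₁) (trans Fx₁≈Fx₂ (F-quarter y₂≈½ θy₂≈x₂))))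
          θy₁≈θy₂ (no y₁≉½) (no y₂≉½) = quadratic-resp (proj₁ (two-to-one y₁ y₂ (y₁∈ , y₁≉½) (y₂∈ , y₂≉½))
            (trans (g≈F∘quadratic y₁≉½ θy₁≈x₁) (trans Fx₁≈Fx₂ (sym (g≈F∘quadratic y₂≉½ θy₂≈x₂)))))
      F-surjective : ∀ z → InFq q z → ∃[ x ] (InFq q x × F x ≈ z)
      F-surjective z = injective⇒surjective InFq-resp Fq-enumerates F (F-closed _) (F-injective _ _)

open import Data.Nat.Base using (_^_; _*_)
open import Relation.Binary.PropositionalEquality using (setoid)

theorem2p10 : ∀ {c ℓ : Level} (R : CommutativeRing c ℓ) (isF : IsField R)
    (p k q n : ℕ) → Prime p → p ≢ 2 → 1 ≤ k → q ≡ p ^ k →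
    CommutativeRing._≈_ R (FieldDefs.natCast R isF p) (CommutativeRing.0# R) →
    Bijection (CommutativeRing.setoid R) (setoid (Fin (q * q))) →
    1 ≤ n →
    let open FieldDefs R isF in
    (IsPermOfFq q (Dickson3 n (CommutativeRing.1# R)) →
      TwoToOneOnS q (g n) × (∀ y → InS q y → ¬ (CommutativeRing._≈_ R (g n y) (nOver2pow n)))) ×
    (TwoToOneOnS q (g n) × (∀ y → InS q y → ¬ (CommutativeRing._≈_ R (g n y) (nOver2pow n))) →
      IsPermOfFq q (Dickson3 n (CommutativeRing.1# R)))
theorem2p10 R isF p k q n p-prime p≢2 1≤k q≡p^k p≈0 enumeration 1≤n =
  permutation⇒twoToOneAvoiding , twoToOneAvoiding⇒permutation
  where
  open OddCharacteristic R isF p-prime p≢2 1≤k q≡p^k p≈0 enumeration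
  open DicksonPermutation 1≤n
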